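{- Let $y_1=w_1\varepsilon^{\mu_1}$ and $y_2=w_2\varepsilon^{\mu_2}$ be elements of $S_{n+1}\ltimes\mathbb{Z}\Phi'$. Then $y_1\le y_2$ in the Bruhat order if and only if for all $i,j\in\{1,\dots,n+1\}$, $$(\mu_1+\varpi_i'-w_1^{ -1}\varpi_{j-1}')_{\mathrm{dom}}\preceq(\mu_2+\varpi_i'-w_2^{ -1}\varpi_{j-1}')_{\mathrm{dom}}.$$
   Context: Fix $n\ge1$. $S_{n+1}$ acts on $\mathbb{Z}^{n+1}$ by $w\cdot(\mu_1,\dots,\mu_{n+1})=(\mu_{w^{ -1}(1)},\dots,\mu_{w^{ -1}(n+1)})$. Let $\mathbb{Z}\Phi'=\{\mu\in\mathbb{Z}^{n+1}:\sum_i\mu_i=0\}$. The group $S_{n+1}\ltimes\mathbb{Z}\Phi'$ has elements $w\varepsilon^\mu$ ($w\in S_{n+1},\mu\in\mathbb{Z}\Phi'$) with product $(w\varepsilon^\mu)(u\varepsilon^\lambda)=wu\,\varepsilon^{u^{ -1}(\mu)+\lambda}$. To $y=w\varepsilon^\mu$ associate the bijection $\pi_y:\mathbb{Z}\to\mathbb{Z}$, $\pi_y(q(n+1)+r)=(q+\mu_r)(n+1)+w(r)$ for $q\in\mathbb{Z}$, $r\in\{1,\dots,n+1\}$; $y\mapsto\pi_y$ is a group isomorphism onto the affine symmetric group $\widetilde S_{n+1}$ of bijections $\pi:\mathbb{Z}\to\mathbb{Z}$ with $\pi(t+n+1)=\pi(t)+n+1$ and $\sum_{t=1}^{n+1}\pi(t)=\binom{n+2}{2}$.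 $\widetilde S_{n+1}$ is a Coxeter group with generators $s_i$ ($1\le i\le n$) given in window notation $[\pi(1),\dots,\pi(n+1)]$ by swapping $i,i+1$ in $[1,\dots,n+1]$, and $s_0=[0,2,3,\dots,n,n+2]$; the Bruhat order on $S_{n+1}\ltimes\mathbb{Z}\Phi'$ is the one transported via $y\mapsto\pi_y$. Let $\varpi_i'=(1,\dots,1,0,\dots,0)\in\mathbb{Z}^{n+1}$ with $i$ ones ($0\le i\le n+1$). For $\mu,\mu'\in\mathbb{Z}^{n+1}$, $\mu\preceq\mu'$ iff $\sum_{i=1}^{n+1}\mu_i=\sum_{i=1}^{n+1}\mu'_i$ and $\sum_{i=1}^m\mu_i\le\sum_{i=1}^m\mu'_i$ for all $m$. $\mu_{\mathrm{dom}}$ denotes the unique weakly decreasing rearrangement of $\mu$. -}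

module Defs where

open import Data.Nat as ℕ using (ℕ; zero; suc)
open import Data.Integer as ℤ using (ℤ; +_; 0ℤ; 1ℤ; _+_; _-_; _*_; _%ℕ_; _/ℕ_)
import Data.Integer.Properties as ℤP
open import Data.Integer.DivMod using (n%ℕd<d)
open import Data.Fin using (Fin; toℕ; fromℕ<)
open import Data.Fin.Permutation using (Permutation′; _⟨$⟩ʳ_)
open import Data.List using (List; []; _∷_; foldr; tabulate; take; length)
open import Data.List.Relation.Binary.Sublist.Propositional using (_⊆_)
open import Data.Product using (Σ; _×_; ∃)
open import Data.Bool using (if_then_else_)
open import Relation.Nullary using (does)
open import Relation.Binary.PropositionalEquality using (_≡_)
open import Relation.Binary.Properties.DecTotalOrder ℤP.≤-decTotalOrder
  using (≥-decTotalOrder)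
open import Data.List.Sort ≥-decTotalOrder using (sort)

-- Throughout, N = suc n = n+1; indices 1..n+1 of the paper are Fin (suc n) = 0..n.

Weight : ℕ → Set
Weight n = Fin (suc n) → ℤ

sumℤ : List ℤ → ℤ
sumℤ = foldr _+_ 0ℤ

toList : ∀ {n} → Weight n → List ℤ
toList {n} μ = tabulate μ

InZΦ' : ∀ {n} → Weight n → Set
InZΦ' μ = sumℤ (toList μ) ≡ 0ℤ

ϖ' : ∀ {n} → ℕ → Weight n
ϖ' i k = if does (suc (toℕ k) ℕ.≤? i) then 1ℤ else 0ℤ

-- w · μ = (μ_{w⁻¹(1)},…), hence (w⁻¹ · μ)_k = μ_{w(k)}
actInv : ∀ {n} → Permutation′ (suc n) → Weight n → Weight n
actInv w μ k = μ (w ⟨$⟩ʳ k)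

_+ʷ_ : ∀ {n} → Weight n → Weight n → Weight n
(μ +ʷ ν) k = μ k + ν k

_-ʷ_ : ∀ {n} → Weight n → Weight n → Weight n
(μ -ʷ ν) k = μ k - ν k

dom : ∀ {n} → Weight n → List ℤ
dom μ = sort (toList μ)

_⪯_ : List ℤ → List ℤ → Set
a ⪯ b = (sumℤ a ≡ sumℤ b) × (∀ m → sumℤ (take m a) ℤ.≤ sumℤ (take m b))

-- for t = q(n+1) + r with r ∈ {1..n+1}: the index r (as Fin, 0-based) and q
rem : ∀ n → ℤ → Fin (suc n)
rem n t = fromℕ< (n%ℕd<d (t - 1ℤ) (suc n))

quo : ∀ n → ℤ → ℤ
quo n t = (t - 1ℤ) /ℕ suc n

πy : ∀ {n} → Permutation′ (suc n) → Weight n → ℤ → ℤ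
πy {n} w μ t = (quo n t + μ (rem n t)) * + suc n + + suc (toℕ (w ⟨$⟩ʳ rem n t))

-- Coxeter generators s_0,…,s_n of the affine symmetric group:
-- s_i swaps the residues i and i+1 mod (n+1) (periodically);
-- for 1 ≤ i ≤ n this is the transposition of i,i+1 in the window,
-- and s_0 = [0,2,3,…,n,n+2].
gen : ∀ {n} → Fin (suc n) → ℤ → ℤ
gen {n} i t =
  if does ((t %ℕ suc n) ℕ.≟ toℕ i) then t + 1ℤ
  else if does ((t %ℕ suc n) ℕ.≟ (suc (toℕ i) ℕ.% suc n)) then t - 1ℤ
  else t

Word : ℕ → Set
Word n = List (Fin (suc n))

eval : ∀ {n} → Word n → ℤ → ℤ
eval [] t = t
eval (a ∷ ws) t = gen a (eval ws t)

Represents : ∀ {n} → Word n → (ℤ → ℤ) → Set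
Represents ws f = ∀ t → eval ws t ≡ f t

Reduced : ∀ {n} → Word n → (ℤ → ℤ) → Set
Reduced {n} ws f = Represents ws f × (∀ (vs : Word n) → Represents vs f → length ws ℕ.≤ length vs)

-- Bruhat order (subword characterization): f ≤ g iff some reduced
-- expression of g has a subword which is an expression of f.
BruhatLe : ∀ n → (ℤ → ℤ) → (ℤ → ℤ) → Set
BruhatLe n f g = Σ (Word n) λ ws → Reduced ws g × Σ (Word n) λ us → (us ⊆ ws) × Represents us f

BruhatLeY : ∀ {n} → Permutation′ (suc n) → Weight n → Permutation′ (suc n) → Weight n → Set
BruhatLeY {n} w₁ μ₁ w₂ μ₂ = BruhatLe n (πy w₁ μ₁) (πy w₂ μ₂)

-- Identify y = w ε^μ with the window W r = μ r N + w(r) + 1 of π_y and let count W i j be the number of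
-- t ≤ i + 1 with π_y t ≥ j. The Bruhat order is the order "count U ≤ count V at every (i, j)", the
-- counting criterion of Björner–Brenti for affine permutations. Left multiplication by a generator s_a
-- changes count only at levels j ≡ a + 1 (mod N), by the 0/1-valued hits of π at j and j − 1; comparing
-- these gives the lifting property, so a subword of a reduced word is below in counts. Conversely, if
-- U ≤ V in counts, a left descent s_a of V lowers Shi's inversion number (the length) and U or s_a U lies
-- below s_a V, so induction on the length yields a reduced word of V with a subword representing U.
-- Finally, writing j − 1 = J + k N, count W i j = Σ_r (v r − k)⁺ with v = μ + ϖ'_{i+1} − w⁻¹ ϖ'_J, and for
-- vectors of equal sum comparing all these excess functions is exactly dominance of the sorted vectors.
module Submission where

open import Defs

module AffineBruhat where
  open import Data.Nat as ℕ using (ℕ; zero; suc)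
  import Data.Nat.Properties as ℕP
  import Data.Nat.DivMod as ℕD
  open import Data.Integer as ℤ
    using (ℤ; +_; -[1+_]; _+_; _-_; _*_; -_; _≤_; _<_; 0ℤ; 1ℤ; -1ℤ; ∣_∣; _%ℕ_; _/ℕ_)
  import Data.Integer.Properties as ℤP
  open import Data.Integer.DivMod using (n%ℕd<d; a≡a%ℕn+[a/ℕn]*n)
  open import Data.Integer.Tactic.RingSolver using (solve-∀)
  open import Data.Fin as F using (Fin; toℕ)
  import Data.Fin.Properties as FP
  open import Data.Fin.Permutation as Perm using (Permutation′; _⟨$⟩ʳ_; _⟨$⟩ˡ_)
  open import Data.List using (List; []; _∷_; length; take; drop; map; tabulate)
  import Data.List.Properties as LP
  open import Data.List.Relation.Binary.Sublist.Propositional using (_⊆_; []; _∷_; _∷ʳ_)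
  open import Data.List.Relation.Unary.All as All using (All; []; _∷_)
  import Data.List.Relation.Unary.All.Properties as AllP
  open import Data.List.Relation.Unary.Linked using (Linked; []; [-]; _∷_)
  open import Data.List.Relation.Binary.Permutation.Propositional using (_↭_; ↭⇒↭ₛ)
  import Data.List.Relation.Binary.Permutation.Propositional.Properties as ↭P
  open import Data.List.Relation.Binary.Permutation.Setoid.Properties ℤP.≡-setoid using (foldr-commMonoid)
  open import Relation.Binary.PropositionalEquality
    using (_≡_; _≢_; refl; sym; trans; cong; cong₂; subst; subst₂; module ≡-Reasoning)
  open import Relation.Binary.Definitions using (tri<; tri≈; tri>)
  open import Data.Product using (Σ; _×_; _,_; proj₁; proj₂)
  open import Data.Sum using (_⊎_; inj₁; inj₂)
  open import Data.Empty using (⊥-elim)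
  open import Data.Bool using (if_then_else_)
  open import Function using (_∘_)
  open import Relation.Nullary using (¬_; yes; no; does)
  open import Relation.Nullary.Decidable using (dec-true; dec-false)
  open import Relation.Binary.Properties.DecTotalOrder ℤP.≤-decTotalOrder using (≥-decTotalOrder)
  open import Data.List.Sort ≥-decTotalOrder using (sort-↭; sort-↗)
  import Algebra.Properties.CommutativeMonoid.Sum as CommutativeMonoidSum
  open import Function.Bundles using (_⇔_; mk⇔; Equivalence)

  ≤-from-diff : ∀ {a b c d} → a ≤ b → b - a ≡ d - c → c ≤ d
  ≤-from-diff h e = ℤP.0≤i-j⇒j≤i (subst (0ℤ ≤_) e (ℤP.i≤j⇒0≤j-i h))

  <⇒+1≤ : ∀ {a b} → a < b → a + 1ℤ ≤ b
  <⇒+1≤ {a} {b} h = subst (_≤ b) (ℤP.+-comm 1ℤ a) (ℤP.i<j⇒suc[i]≤j h)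

  +1≤⇒< : ∀ {a b} → a + 1ℤ ≤ b → a < b
  +1≤⇒< {a} {b} h = ℤP.suc[i]≤j⇒i<j (subst (_≤ b) (ℤP.+-comm a 1ℤ) h)

  <-from-diff : ∀ {a b c d} → a < b → b - a ≡ d - c → c < d
  <-from-diff {a} {b} {c} {d} h e =
    +1≤⇒< (≤-from-diff (<⇒+1≤ h) (trans (minus-+1 a b) (trans (cong (_- 1ℤ) e) (sym (minus-+1 c d)))))
    where
    minus-+1 : ∀ a b → b - (a + 1ℤ) ≡ b - a - 1ℤ
    minus-+1 = solve-∀

  ≤-or-> : ∀ a b → a ≤ b ⊎ b < a
  ≤-or-> a b with a ℤP.≤? b
  ... | yes h = inj₁ h
  ... | no h = inj₂ (ℤP.≰⇒> h)

  ≤-offset : ∀ {a b} → a ≤ b → Σ ℕ λ k → b ≡ a + + k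
  ≤-offset {a} {b} a≤b =
    ∣ b - a ∣ , trans (sym (a+[b-a] a b)) (cong (λ x → a + x) (sym (ℤP.0≤i⇒+∣i∣≡i (ℤP.i≤j⇒0≤j-i a≤b))))
    where
    a+[b-a] : ∀ a b → a + (b - a) ≡ b
    a+[b-a] = solve-∀

  0≤⇒0<+1 : ∀ {q} → 0ℤ ≤ q → 0ℤ < q + 1ℤ
  0≤⇒0<+1 h = +1≤⇒< (ℤP.+-monoˡ-≤ 1ℤ h)

  +-cancelʳ : ∀ a b c → a + c ≡ b + c → a ≡ b
  +-cancelʳ a b c eq = trans (a+c-c a c) (trans (cong (_- c) eq) (sym (a+c-c b c)))
    where
    a+c-c : ∀ a c → a ≡ a + c - c
    a+c-c = solve-∀

  _⁺ : ℤ → ℤ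
  (+ k) ⁺ = + k
  -[1+ k ] ⁺ = 0ℤ

  𝟙[_>0] : ℤ → ℤ
  𝟙[ + suc _ >0] = 1ℤ
  𝟙[ _ >0] = 0ℤ

  ⁺-nonneg : ∀ y → 0ℤ ≤ y ⁺
  ⁺-nonneg (+ k) = ℤ.+≤+ ℕ.z≤n
  ⁺-nonneg -[1+ k ] = ℤP.≤-refl

  ≤⁺ : ∀ y → y ≤ y ⁺
  ≤⁺ (+ k) = ℤP.≤-refl
  ≤⁺ -[1+ k ] = ℤ.-≤+

  ⁺-of-nonneg : ∀ y → 0ℤ ≤ y → y ⁺ ≡ y
  ⁺-of-nonneg (+ k) h = refl

  ⁺-of-nonpos : ∀ y → y ≤ 0ℤ → y ⁺ ≡ 0ℤ
  ⁺-of-nonpos (+ zero) h = refl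
  ⁺-of-nonpos (+ suc k) (ℤ.+≤+ ())
  ⁺-of-nonpos -[1+ k ] h = refl

  ⁺-+1 : ∀ y → (y + 1ℤ) ⁺ ≡ y ⁺ + 𝟙[ y + 1ℤ >0]
  ⁺-+1 (+ k) rewrite ℕP.+-comm k 1 = cong +_ (ℕP.+-comm 1 k)
  ⁺-+1 -[1+ zero ] = refl
  ⁺-+1 -[1+ suc k ] = refl

  𝟙-of-pos : ∀ y → 0ℤ < y → 𝟙[ y >0] ≡ 1ℤ
  𝟙-of-pos (+ suc k) h = refl
  𝟙-of-pos (+ zero) (ℤ.+<+ ())

  𝟙-of-nonpos : ∀ y → y ≤ 0ℤ → 𝟙[ y >0] ≡ 0ℤ
  𝟙-of-nonpos (+ zero) h = refl
  𝟙-of-nonpos (+ suc k) (ℤ.+≤+ ())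
  𝟙-of-nonpos -[1+ k ] h = refl

  Bit : ℤ → Set
  Bit p = p ≡ 0ℤ ⊎ p ≡ 1ℤ

  𝟙-bit : ∀ y → Bit 𝟙[ y >0]
  𝟙-bit (+ zero) = inj₁ refl
  𝟙-bit (+ suc k) = inj₂ refl
  𝟙-bit -[1+ k ] = inj₁ refl

  bit-nonneg : ∀ {x} → Bit x → 0ℤ ≤ x
  bit-nonneg (inj₁ refl) = ℤP.≤-refl
  bit-nonneg (inj₂ refl) = ℤ.+≤+ ℕ.z≤n

  bit≤0⇒≡0 : ∀ {x} → Bit x → x ≤ 0ℤ → x ≡ 0ℤ
  bit≤0⇒≡0 (inj₁ e) h = e
  bit≤0⇒≡0 (inj₂ refl) (ℤ.+≤+ ())

  bit≥1⇒≡1 : ∀ {x} → Bit x → 1ℤ ≤ x → x ≡ 1ℤ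
  bit≥1⇒≡1 (inj₁ refl) (ℤ.+≤+ ())
  bit≥1⇒≡1 (inj₂ e) h = e

  z-1+1≡z : ∀ z → z - 1ℤ + 1ℤ ≡ z
  z-1+1≡z = solve-∀

  z+1-1≡z : ∀ z → z + 1ℤ - 1ℤ ≡ z
  z+1-1≡z = solve-∀

  ∣k-1∣≡∣k∣+1 : ∀ k → k ≤ 0ℤ → + ∣ k - 1ℤ ∣ ≡ + ∣ k ∣ + 1ℤ
  ∣k-1∣≡∣k∣+1 (+ zero) _ = refl
  ∣k-1∣≡∣k∣+1 (+ suc m) (ℤ.+≤+ ())
  ∣k-1∣≡∣k∣+1 -[1+ m ] _ = cong (λ x → + suc x) (trans (cong suc (ℕP.+-identityʳ m)) (ℕP.+-comm 1 m))

  ∣k-1∣+1≡∣k∣ : ∀ k → 1ℤ ≤ k → + ∣ k - 1ℤ ∣ + 1ℤ ≡ + ∣ k ∣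
  ∣k-1∣+1≡∣k∣ (+ zero) (ℤ.+≤+ ())
  ∣k-1∣+1≡∣k∣ (+ suc m) _ = cong +_ (ℕP.+-comm m 1)

  cancel-+1ʳ : ∀ a b x → a + x ≡ b + (x + 1ℤ) → a ≡ b + 1ℤ
  cancel-+1ʳ a b x h = +-cancelʳ a (b + 1ℤ) x (trans h (shape b x))
    where
    shape : ∀ b x → b + (x + 1ℤ) ≡ b + 1ℤ + x
    shape = solve-∀

  cancel-+1ˡ : ∀ a b x → a + (x + 1ℤ) ≡ b + x → a + 1ℤ ≡ b
  cancel-+1ˡ a b x h = +-cancelʳ (a + 1ℤ) b x (trans (shape a x) h)
    where
    shape : ∀ a x → a + 1ℤ + x ≡ a + (x + 1ℤ)
    shape = solve-∀

  +-cancelʳ-≤ : ∀ a b c → a + c ≤ b + c → a ≤ b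
  +-cancelʳ-≤ a b c h = ≤-from-diff h (shape a b c)
    where
    shape : ∀ a b c → b + c - (a + c) ≡ b - a
    shape = solve-∀

  ∑ : ∀ {m} → (Fin m → ℤ) → ℤ
  ∑ f = sumℤ (tabulate f)

  ∑-cong : ∀ {m} {f g : Fin m → ℤ} → (∀ r → f r ≡ g r) → ∑ f ≡ ∑ g
  ∑-cong {zero} h = refl
  ∑-cong {suc m} h = cong₂ _+_ (h F.zero) (∑-cong (λ r → h (F.suc r)))

  ∑-+ : ∀ {m} (f g : Fin m → ℤ) → ∑ (λ r → f r + g r) ≡ ∑ f + ∑ g
  ∑-+ {zero} f g = refl
  ∑-+ {suc m} f g =
    trans (cong (λ u → f F.zero + g F.zero + u) (∑-+ (λ r → f (F.suc r)) (λ r → g (F.suc r))))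
          (interchange (f F.zero) (g F.zero) _ _)
    where
    interchange : ∀ a b c d → (a + b) + (c + d) ≡ (a + c) + (b + d)
    interchange = solve-∀

  ∑-neg : ∀ {m} (f : Fin m → ℤ) → ∑ (λ r → - f r) ≡ - ∑ f
  ∑-neg {zero} f = refl
  ∑-neg {suc m} f =
    trans (cong (λ u → - f F.zero + u) (∑-neg (λ r → f (F.suc r)))) (sym (ℤP.neg-distrib-+ (f F.zero) _))

  ∑-minus : ∀ {m} (f g : Fin m → ℤ) → ∑ (λ r → f r - g r) ≡ ∑ f - ∑ g
  ∑-minus f g = trans (∑-+ f (λ r → - g r)) (cong (λ u → ∑ f + u) (∑-neg g))

  ∑-*ʳ : ∀ {m} (f : Fin m → ℤ) c → ∑ (λ r → f r * c) ≡ ∑ f * c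
  ∑-*ʳ {zero} f c = refl
  ∑-*ʳ {suc m} f c =
    trans (cong (λ u → f F.zero * c + u) (∑-*ʳ (λ r → f (F.suc r)) c)) (sym (ℤP.*-distribʳ-+ c (f F.zero) _))

  ∑-const : ∀ {m} c → ∑ {m} (λ _ → c) ≡ + m * c
  ∑-const {zero} c = refl
  ∑-const {suc m} c = trans (cong (λ u → c + u) (∑-const {m} c)) (sym (ℤP.suc-* (+ m) c))

  ∑-zero : ∀ {m} {f : Fin m → ℤ} → (∀ r → f r ≡ 0ℤ) → ∑ f ≡ 0ℤ
  ∑-zero {zero} h = refl
  ∑-zero {suc m} h = cong₂ _+_ (h F.zero) (∑-zero (λ r → h (F.suc r)))

  ∑-nonneg : ∀ {m} {f : Fin m → ℤ} → (∀ r → 0ℤ ≤ f r) → 0ℤ ≤ ∑ f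
  ∑-nonneg {zero} h = ℤP.≤-refl
  ∑-nonneg {suc m} h = ℤP.+-mono-≤ (h F.zero) (∑-nonneg (λ r → h (F.suc r)))

  ∑-single : ∀ {m} {f : Fin m → ℤ} e → (∀ r → r ≢ e → f r ≡ 0ℤ) → ∑ f ≡ f e
  ∑-single {suc m} {f} F.zero h =
    trans (cong (λ u → f F.zero + u) (∑-zero (λ r → h (F.suc r) (λ ())))) (ℤP.+-identityʳ _)
  ∑-single {suc m} {f} (F.suc e) h =
    trans (cong (_+ ∑ (λ r → f (F.suc r))) (h F.zero (λ ())))
          (trans (ℤP.+-identityˡ _)
                 (∑-single {f = λ r → f (F.suc r)} e (λ r r≢e → h (F.suc r) (r≢e ∘ FP.suc-injective))))

  term≤∑ : ∀ {m} {f : Fin m → ℤ} e → (∀ r → 0ℤ ≤ f r) → f e ≤ ∑ f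
  term≤∑ {suc m} {f} F.zero h =
    subst (_≤ ∑ f) (ℤP.+-identityʳ (f F.zero)) (ℤP.+-monoʳ-≤ (f F.zero) (∑-nonneg (λ r → h (F.suc r))))
  term≤∑ {suc m} {f} (F.suc e) h =
    subst (_≤ ∑ f) (ℤP.+-identityˡ (f (F.suc e)))
          (ℤP.+-mono-≤ (h F.zero) (term≤∑ {f = λ r → f (F.suc r)} e (λ r → h (F.suc r))))

  ∑-update : ∀ {m} {f g : Fin m → ℤ} e → (∀ r → r ≢ e → f r ≡ g r) → ∑ f + g e ≡ ∑ g + f e
  ∑-update {suc m} {f} {g} F.zero h =
    trans (cong (λ x → f F.zero + x + g F.zero) (∑-cong (λ r → h (F.suc r) (λ ()))))
          (swap-ends (f F.zero) _ (g F.zero))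
    where
    swap-ends : ∀ a s b → a + s + b ≡ b + s + a
    swap-ends = solve-∀
  ∑-update {suc m} {f} {g} (F.suc e) h =
    trans (ℤP.+-assoc (f F.zero) _ (g (F.suc e)))
     (trans (cong₂ _+_ (h F.zero (λ ()))
                       (∑-update {f = λ r → f (F.suc r)} {g = λ r → g (F.suc r)} e
                                 (λ r r≢e → h (F.suc r) (r≢e ∘ FP.suc-injective))))
            (sym (ℤP.+-assoc (g F.zero) _ _)))

  ∑-update₂ : ∀ {m} {f g : Fin m → ℤ} p q → p ≢ q → (∀ r → r ≢ p → r ≢ q → f r ≡ g r) →
              ∑ f + g p + g q ≡ ∑ g + f p + f q
  ∑-update₂ {m} {f} {g} p q p≢q h = begin
    ∑ f + g p + g q      ≡⟨ cong (λ x → ∑ f + x + g q) (sym h′p≡gp) ⟩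
    ∑ f + h′ p + g q     ≡⟨ cong (_+ g q) (∑-update {f = f} {g = h′} p f≡h) ⟩
    ∑ h′ + f p + g q     ≡⟨ reorder (∑ h′) (f p) (g q) ⟩
    ∑ h′ + g q + f p     ≡⟨ cong (_+ f p) (∑-update {f = h′} {g = g} q h≡g) ⟩
    ∑ g + h′ q + f p     ≡⟨ cong (λ x → ∑ g + x + f p) h′q≡fq ⟩
    ∑ g + f q + f p      ≡⟨ reorder (∑ g) (f q) (f p) ⟩
    ∑ g + f p + f q      ∎
    where
    open ≡-Reasoning
    h′ : Fin m → ℤ
    h′ r with r FP.≟ p
    ... | yes _ = g p
    ... | no _ = f r
    f≡h : ∀ r → r ≢ p → f r ≡ h′ r
    f≡h r r≢p with r FP.≟ p
    ... | yes r≡p = ⊥-elim (r≢p r≡p)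
    ... | no _ = refl
    h≡g : ∀ r → r ≢ q → h′ r ≡ g r
    h≡g r r≢q with r FP.≟ p
    ... | yes refl = refl
    ... | no r≢p = h r r≢p r≢q
    h′p≡gp : h′ p ≡ g p
    h′p≡gp with p FP.≟ p
    ... | yes _ = refl
    ... | no p≢p = ⊥-elim (p≢p refl)
    h′q≡fq : h′ q ≡ f q
    h′q≡fq with q FP.≟ p
    ... | yes q≡p = ⊥-elim (p≢q (sym q≡p))
    ... | no _ = refl
    reorder : ∀ a b c → a + b + c ≡ a + c + b
    reorder = solve-∀

  ∑-≤-≡⇒≡ : ∀ {m} (f g : Fin m → ℤ) → (∀ r → f r ≤ g r) → ∑ f ≡ ∑ g → ∀ r → f r ≡ g r
  ∑-≤-≡⇒≡ f g f≤g ∑f≡∑g r = ℤP.≤-antisym (f≤g r) (ℤP.i-j≤0⇒i≤j gap≤0)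
    where
    gap≤0 : g r - f r ≤ 0ℤ
    gap≤0 = subst (g r - f r ≤_)
                  (trans (∑-minus g f) (trans (cong (_- ∑ f) (sym ∑f≡∑g)) (ℤP.+-inverseʳ (∑ f))))
                  (term≤∑ {f = λ r → g r - f r} r (λ r → ℤP.i≤j⇒0≤j-i (f≤g r)))

  module ∑ᶜ = CommutativeMonoidSum ℤP.+-0-commutativeMonoid

  ∑≡library-sum : ∀ {m} (f : Fin m → ℤ) → ∑ f ≡ ∑ᶜ.sum f
  ∑≡library-sum {zero} f = refl
  ∑≡library-sum {suc m} f = cong (λ u → f F.zero + u) (∑≡library-sum (λ r → f (F.suc r)))

  ∑-permute : ∀ {m} (f : Fin m → ℤ) (π : Permutation′ m) → ∑ f ≡ ∑ (λ r → f (π ⟨$⟩ʳ r))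
  ∑-permute f π =
    trans (∑≡library-sum f) (trans (∑ᶜ.sum-permute f π) (sym (∑≡library-sum (λ r → f (π ⟨$⟩ʳ r)))))

  excess : ℤ → List ℤ → ℤ
  excess k L = sumℤ (map (λ x → (x - k) ⁺) L)

  excess-nonneg : ∀ k L → 0ℤ ≤ excess k L
  excess-nonneg k [] = ℤP.≤-refl
  excess-nonneg k (x ∷ L) = ℤP.+-mono-≤ (⁺-nonneg (x - k)) (excess-nonneg k L)

  sum-take≤ : ∀ m L k → sumℤ (take m L) ≤ + length (take m L) * k + excess k L
  sum-take≤ zero L k = ≤-from-diff (excess-nonneg k L) (shape k (excess k L))
    where
    shape : ∀ k g → g - 0ℤ ≡ 0ℤ * k + g - 0ℤ
    shape = solve-∀
  sum-take≤ (suc m) [] k = ℤP.≤-refl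
  sum-take≤ (suc m) (x ∷ L) k =
    ≤-from-diff (ℤP.+-mono-≤ (≤⁺ (x - k)) (sum-take≤ m L k))
                (shape x k ((x - k) ⁺) (sumℤ (take m L)) (+ length (take m L)) (excess k L))
    where
    shape : ∀ x k p s l g → (p + (l * k + g)) - (x - k + s) ≡ ((1ℤ + l) * k + (p + g)) - (x + s)
    shape = solve-∀

  SplitsAt : ℕ → ℤ → List ℤ → Set
  SplitsAt m k L = All (k ≤_) (take m L) × All (_≤ k) (drop m L)

  excess-of-≤ : ∀ k L → All (_≤ k) L → excess k L ≡ 0ℤ
  excess-of-≤ k [] [] = refl
  excess-of-≤ k (x ∷ L) (x≤k ∷ L≤k) =
    cong₂ _+_ (⁺-of-nonpos (x - k) (ℤP.i≤j⇒i-j≤0 x≤k)) (excess-of-≤ k L L≤k)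

  excess-at-split : ∀ m k L → SplitsAt m k L → excess k L ≡ sumℤ (take m L) - + length (take m L) * k
  excess-at-split zero k L (_ , L≤k) = trans (excess-of-≤ k L L≤k) (shape k)
    where
    shape : ∀ k → 0ℤ ≡ 0ℤ - 0ℤ * k
    shape = solve-∀
  excess-at-split (suc m) k [] _ = shape k
    where
    shape : ∀ k → 0ℤ ≡ 0ℤ - 0ℤ * k
    shape = solve-∀
  excess-at-split (suc m) k (x ∷ L) (k≤x ∷ above , below) =
    trans (cong₂ _+_ (⁺-of-nonneg (x - k) (ℤP.i≤j⇒0≤j-i k≤x)) (excess-at-split m k L (above , below)))
          (shape x k (sumℤ (take m L)) (+ length (take m L)))
    where
    shape : ∀ x k s l → x - k + (s - l * k) ≡ x + s - (1ℤ + l) * k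
    shape = solve-∀

  Descending : List ℤ → Set
  Descending = Linked (λ a b → b ≤ a)

  descending-tail : ∀ {x L} → Descending (x ∷ L) → Descending L
  descending-tail [-] = []
  descending-tail (_ ∷ d) = d

  head-bounds : ∀ {x L} → Descending (x ∷ L) → All (_≤ x) L
  head-bounds [-] = []
  head-bounds (y≤x ∷ d) = y≤x ∷ All.map (λ z≤y → ℤP.≤-trans z≤y y≤x) (head-bounds d)

  split-at-level : ∀ L → Descending L → ∀ k → Σ ℕ λ m → SplitsAt m k L
  split-at-level [] d k = 0 , [] , []
  split-at-level (x ∷ L) d k with ≤-or-> x k
  ... | inj₁ x≤k = 0 , [] , (x≤k ∷ All.map (λ y≤x → ℤP.≤-trans y≤x x≤k) (head-bounds d))
  ... | inj₂ k<x with split-at-level L (descending-tail d) k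
  ...   | m , above , below = suc m , (ℤP.<⇒≤ k<x ∷ above) , below

  split-at-position : ∀ L → Descending L → ∀ m → Σ ℤ λ k → SplitsAt m k L
  split-at-position [] d zero = 0ℤ , [] , []
  split-at-position [] d (suc m) = 0ℤ , [] , []
  split-at-position (x ∷ L) d zero = x , [] , (ℤP.≤-refl ∷ head-bounds d)
  split-at-position (x ∷ L) d (suc m) with split-at-position L (descending-tail d) m
  ... | k , above , below with ≤-or-> x k
  ...   | inj₁ x≤k = x , (ℤP.≤-refl ∷ All.map (ℤP.≤-trans x≤k) above) , AllP.drop⁺ m (head-bounds d)
  ...   | inj₂ k<x = k , (ℤP.<⇒≤ k<x ∷ above) , below

  length-take-≡ : ∀ m (La Lb : List ℤ) → length La ≡ length Lb → length (take m La) ≡ length (take m Lb)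
  length-take-≡ m La Lb e = trans (LP.length-take m La) (trans (cong (m ℕ.⊓_) e) (sym (LP.length-take m Lb)))

  partial-sums≤⇒excess≤ : ∀ La Lb → Descending La → length La ≡ length Lb →
                          (∀ m → sumℤ (take m La) ≤ sumℤ (take m Lb)) → ∀ k → excess k La ≤ excess k Lb
  partial-sums≤⇒excess≤ La Lb da same-length sums≤ k with split-at-level La da k
  ... | m , split =
    subst (_≤ excess k Lb) (sym (excess-at-split m k La split))
      (subst (λ l → sumℤ (take m La) - + l * k ≤ excess k Lb) (sym (length-take-≡ m La Lb same-length))
        (≤-from-diff (ℤP.+-mono-≤ (sums≤ m) (sum-take≤ m Lb k))
                     (shape (sumℤ (take m La)) (sumℤ (take m Lb)) (+ length (take m Lb) * k) (excess k Lb))))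
    where
    shape : ∀ a b c g → (b + (c + g)) - (a + b) ≡ g - (a - c)
    shape = solve-∀

  excess≤⇒partial-sums≤ : ∀ La Lb → Descending Lb → length La ≡ length Lb →
                          (∀ k → excess k La ≤ excess k Lb) → ∀ m → sumℤ (take m La) ≤ sumℤ (take m Lb)
  excess≤⇒partial-sums≤ La Lb db same-length excess≤ m with split-at-position Lb db m
  ... | k , split =
    ℤP.≤-trans (sum-take≤ m La k)
      (subst (λ l → + l * k + excess k La ≤ sumℤ (take m Lb)) (sym (length-take-≡ m La Lb same-length))
        (≤-from-diff (excess≤ k)
                     (shape (sumℤ (take m Lb)) (+ length (take m Lb) * k) (excess k La) (excess k Lb)
                            (excess-at-split m k Lb split))))
    where
    shape : ∀ s c ga gb → gb ≡ s - c → gb - ga ≡ s - (c + ga)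
    shape s c ga gb e = trans (cong (_- ga) e) (s-c-g s c ga)
      where
      s-c-g : ∀ s c ga → s - c - ga ≡ s - (c + ga)
      s-c-g = solve-∀

  sumℤ-↭ : ∀ {L L′ : List ℤ} → L ↭ L′ → sumℤ L ≡ sumℤ L′
  sumℤ-↭ p = foldr-commMonoid ℤP.+-0-isCommutativeMonoid (↭⇒↭ₛ p)

  ⪯⇔excess≤ : ∀ La Lb → Descending La → Descending Lb → length La ≡ length Lb → sumℤ La ≡ sumℤ Lb →
              La ⪯ Lb ⇔ (∀ k → excess k La ≤ excess k Lb)
  ⪯⇔excess≤ La Lb da db same-length same-sum = mk⇔
    (λ (_ , sums≤) → partial-sums≤⇒excess≤ La Lb da same-length sums≤)
    (λ excess≤ → same-sum , excess≤⇒partial-sums≤ La Lb db same-length excess≤)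

  module Residues (n : ℕ) where

    N : ℕ
    N = suc n

    Nℤ : ℤ
    Nℤ = + N

    divN : ℤ → ℤ
    divN z = z /ℕ N

    modN : ℤ → ℕ
    modN z = z %ℕ N

    modN<N : ∀ z → modN z ℕ.< N
    modN<N z = n%ℕd<d z N

    modN+divN : ∀ z → z ≡ + modN z + divN z * Nℤ
    modN+divN z = a≡a%ℕn+[a/ℕn]*n z N

    <-by-quotient : ∀ r q r′ q′ → r ℕ.< N → q < q′ → + r + q * Nℤ < + r′ + q′ * Nℤ
    <-by-quotient r q r′ q′ r<N q<q′ =
      ℤP.<-≤-trans (subst (+ r + q * Nℤ <_) (sym (ℤP.suc-* q Nℤ)) (ℤP.+-monoˡ-< (q * Nℤ) (ℤ.+<+ r<N)))
        (ℤP.≤-trans (ℤP.*-monoʳ-≤-nonNeg Nℤ (ℤP.i<j⇒suc[i]≤j q<q′)) (ℤP.i≤j⇒i≤k+j (+ r′) ℤP.≤-refl))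

    divmod-unique : ∀ r q r′ q′ → r ℕ.< N → r′ ℕ.< N → + r + q * Nℤ ≡ + r′ + q′ * Nℤ → r ≡ r′ × q ≡ q′
    divmod-unique r q r′ q′ r<N r′<N eq with ℤP.<-cmp q q′
    ... | tri< q<q′ _ _ = ⊥-elim (ℤP.<-irrefl eq (<-by-quotient r q r′ q′ r<N q<q′))
    ... | tri> _ _ q>q′ = ⊥-elim (ℤP.<-irrefl (sym eq) (<-by-quotient r′ q′ r q r′<N q>q′))
    ... | tri≈ _ refl _ = ℤP.+-injective (+-cancelʳ (+ r) (+ r′) (q * Nℤ) eq) , refl

    divmod-char : ∀ z r q → r ℕ.< N → z ≡ + r + q * Nℤ → modN z ≡ r × divN z ≡ q
    divmod-char z r q r<N eq = divmod-unique (modN z) (divN z) r q (modN<N z) r<N (trans (sym (modN+divN z)) eq)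

    modN-char : ∀ z r q → r ℕ.< N → z ≡ + r + q * Nℤ → modN z ≡ r
    modN-char z r q r<N eq = proj₁ (divmod-char z r q r<N eq)

    divN-char : ∀ z r q → r ℕ.< N → z ≡ + r + q * Nℤ → divN z ≡ q
    divN-char z r q r<N eq = proj₂ (divmod-char z r q r<N eq)

    divN-bounds : ∀ z q → q * Nℤ ≤ z → z < q * Nℤ + Nℤ → divN z ≡ q
    divN-bounds z q lower upper with ≤-offset lower
    ... | m , z≡ = divN-char z m q m<N (trans z≡ (ℤP.+-comm (q * Nℤ) (+ m)))
      where
      m<N : m ℕ.< N
      m<N = ℤP.drop‿+<+ (<-from-diff upper (trans (cong (λ u → q * Nℤ + Nℤ - u) z≡) (shape (q * Nℤ) (+ m) Nℤ)))
        where
        shape : ∀ a b c → a + c - (a + b) ≡ c - b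
        shape = solve-∀

    modN-suc : ∀ z → (modN z ℕ.< n × modN (z + 1ℤ) ≡ suc (modN z) × divN (z + 1ℤ) ≡ divN z)
                  ⊎ (modN z ≡ n × modN (z + 1ℤ) ≡ 0 × divN (z + 1ℤ) ≡ divN z + 1ℤ)
    modN-suc z with ℕP.m≤n⇒m<n∨m≡n (ℕP.≤-pred (modN<N z))
    ... | inj₁ lt = inj₁ (lt , divmod-char (z + 1ℤ) (suc (modN z)) (divN z) (ℕ.s≤s lt) z+1≡)
      where
      z+1≡ : z + 1ℤ ≡ + suc (modN z) + divN z * Nℤ
      z+1≡ = trans (cong (_+ 1ℤ) (modN+divN z))
               (shape (+ modN z) (divN z * Nℤ))
        where
        shape : ∀ a b → a + b + 1ℤ ≡ 1ℤ + a + b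
        shape = solve-∀
    ... | inj₂ r≡n = inj₂ (r≡n , divmod-char (z + 1ℤ) 0 (divN z + 1ℤ) (ℕ.s≤s ℕ.z≤n) z+1≡)
      where
      1+r≡N : 1ℤ + + modN z ≡ Nℤ
      1+r≡N = cong (λ k → + suc k) r≡n
      z+1≡ : z + 1ℤ ≡ + 0 + (divN z + 1ℤ) * Nℤ
      z+1≡ = begin
        z + 1ℤ                             ≡⟨ cong (_+ 1ℤ) (modN+divN z) ⟩
        + modN z + divN z * Nℤ + 1ℤ        ≡⟨ shape (+ modN z) (divN z * Nℤ) ⟩
        1ℤ + + modN z + divN z * Nℤ        ≡⟨ cong (_+ divN z * Nℤ) 1+r≡N ⟩
        Nℤ + divN z * Nℤ                   ≡⟨ shape′ (divN z) Nℤ ⟩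
        + 0 + (divN z + 1ℤ) * Nℤ           ∎
        where
        open ≡-Reasoning
        shape : ∀ a b → a + b + 1ℤ ≡ 1ℤ + a + b
        shape = solve-∀
        shape′ : ∀ q m → m + q * m ≡ + 0 + (q + 1ℤ) * m
        shape′ = solve-∀

    modN-pred : ∀ z → (modN (z - 1ℤ) ℕ.< n × modN z ≡ suc (modN (z - 1ℤ)) × divN (z - 1ℤ) ≡ divN z)
                  ⊎ (modN (z - 1ℤ) ≡ n × modN z ≡ 0 × divN (z - 1ℤ) + 1ℤ ≡ divN z)
    modN-pred z with modN-suc (z - 1ℤ)
    ... | inj₁ (r<n , r′≡ , q′≡) =
      inj₁ (r<n , subst (λ x → modN x ≡ suc (modN (z - 1ℤ))) (z-1+1≡z z) r′≡
                , sym (subst (λ x → divN x ≡ divN (z - 1ℤ)) (z-1+1≡z z) q′≡))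
    ... | inj₂ (r≡n , r′≡ , q′≡) =
      inj₂ (r≡n , subst (λ x → modN x ≡ 0) (z-1+1≡z z) r′≡
                , sym (subst (λ x → divN x ≡ divN (z - 1ℤ) + 1ℤ) (z-1+1≡z z) q′≡))

    divN-pred : ∀ z → modN z ≢ 0 → divN (z - 1ℤ) ≡ divN z
    divN-pred z r≢0 with modN-pred z
    ... | inj₁ (_ , _ , q≡) = q≡
    ... | inj₂ (_ , r≡0 , _) = ⊥-elim (r≢0 r≡0)

    divN-suc : ∀ z → modN (z + 1ℤ) ≢ 0 → divN (z + 1ℤ) ≡ divN z
    divN-suc z r≢0 = trans (sym (divN-pred (z + 1ℤ) r≢0)) (cong divN (z+1-1≡z z))

    modN-divN-shift : ∀ z q → modN (z + q * Nℤ) ≡ modN z × divN (z + q * Nℤ) ≡ divN z + q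
    modN-divN-shift z q =
      divmod-char (z + q * Nℤ) (modN z) (divN z + q) (modN<N z)
        (trans (cong (_+ q * Nℤ) (modN+divN z)) (shape (+ modN z) (divN z) q Nℤ))
      where
      shape : ∀ a b q c → a + b * c + q * c ≡ a + (b + q) * c
      shape = solve-∀

    modN-shift : ∀ z q → modN (z + q * Nℤ) ≡ modN z
    modN-shift z q = proj₁ (modN-divN-shift z q)

    modN-diff≡0 : ∀ x y → modN x ≡ modN y → modN (x - y) ≡ 0
    modN-diff≡0 x y eq =
      modN-char (x - y) 0 (divN x - divN y) (ℕ.s≤s ℕ.z≤n)
        (trans (cong₂ _-_ (modN+divN x) (modN+divN y))
          (trans (shape (+ modN x) (divN x) (+ modN y) (divN y) Nℤ)
            (cong (λ u → u + (divN x - divN y) * Nℤ)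
                  (trans (cong (λ k → + modN x - + k) (sym eq)) (ℤP.+-inverseʳ (+ modN x))))))
      where
      shape : ∀ a b c d e → (a + b * e) - (c + d * e) ≡ (a - c) + (b - d) * e
      shape = solve-∀

    modN-diff≡0⇒≡ : ∀ x y → modN (x - y) ≡ 0 → modN x ≡ modN y
    modN-diff≡0⇒≡ x y eq = begin
      modN x                                  ≡⟨ cong modN (shape x y) ⟩
      modN (y + (x - y))                      ≡⟨ cong (λ u → modN (y + u)) (modN+divN (x - y)) ⟩
      modN (y + (+ modN (x - y) + q * Nℤ))    ≡⟨ cong (λ k → modN (y + (+ k + q * Nℤ))) eq ⟩
      modN (y + (0ℤ + q * Nℤ))                ≡⟨ cong (λ u → modN (y + u)) (ℤP.+-identityˡ (q * Nℤ)) ⟩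
      modN (y + q * Nℤ)                       ≡⟨ modN-shift y q ⟩
      modN y                                  ∎
      where
      open ≡-Reasoning
      q : ℤ
      q = divN (x - y)
      shape : ∀ x y → x ≡ y + (x - y)
      shape = solve-∀

    modN-small : ∀ k → k ℕ.< N → modN (+ k) ≡ k
    modN-small k k<N = ℕD.m<n⇒m%n≡m k<N

    modN-diff≢0 : ∀ x y → modN x ≢ modN y → modN (x - y) ≢ 0
    modN-diff≢0 x y ne e = ne (modN-diff≡0⇒≡ x y e)

    *N-mono : ∀ {q p} → q ≤ p → q * Nℤ ≤ p * Nℤ
    *N-mono = ℤP.*-monoʳ-≤-nonNeg Nℤ

    shifted≤-of-≤ : ∀ e i q → e ℕ.≤ i → 0ℤ ≤ q → + e - q * Nℤ ≤ + i
    shifted≤-of-≤ e i q e≤i 0≤q =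
      ≤-from-diff (ℤP.+-mono-≤ (ℤ.+≤+ e≤i) (*N-mono {0ℤ} {q} 0≤q)) (shape (+ e) (+ i) (q * Nℤ))
      where
      shape : ∀ e i x → (i + x) - (e + 0ℤ * Nℤ) ≡ i - (e - x)
      shape = solve-∀

    shifted≤-of-pos : ∀ e i q → e ℕ.< N → 0ℤ < q → + e - q * Nℤ ≤ + i
    shifted≤-of-pos e i q e<N 0<q =
      ≤-from-diff (ℤP.<⇒≤ (ℤP.+-mono-<-≤ (ℤP.+-mono-<-≤ (ℤ.+<+ e<N) (*N-mono (<⇒+1≤ 0<q))) (ℤ.+≤+ {0} {i} ℕ.z≤n)))
                  (shape (+ e) (+ i) (q * Nℤ) Nℤ)
      where
      shape : ∀ e i x m → (m + x + i) - (e + (0ℤ + 1ℤ) * m + 0ℤ) ≡ i - (e - x)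
      shape = solve-∀

    shifted>-of-neg : ∀ e i q → i ℕ.< N → q < 0ℤ → + i < + e - q * Nℤ
    shifted>-of-neg e i q i<N q<0 =
      <-from-diff (ℤP.+-mono-<-≤ (ℤP.+-mono-<-≤ (ℤ.+<+ i<N) (*N-mono (ℤP.i<j⇒i≤pred[j] q<0))) (ℤ.+≤+ {0} {e} ℕ.z≤n))
                  (shape (+ e) (+ i) (q * Nℤ) Nℤ)
      where
      shape : ∀ e i x m → (m + (-1ℤ * m) + e) - (i + x + 0ℤ) ≡ (e - x) - i
      shape = solve-∀

    shifted>-of-nonpos : ∀ e i q → i ℕ.< e → q ≤ 0ℤ → + i < + e - q * Nℤ
    shifted>-of-nonpos e i q i<e q≤0 =
      <-from-diff (ℤP.+-mono-<-≤ (ℤ.+<+ i<e) (*N-mono q≤0)) (shape (+ e) (+ i) (q * Nℤ) Nℤ)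
      where
      shape : ∀ e i x m → (e + 0ℤ * m) - (i + x) ≡ (e - x) - i
      shape = solve-∀


    quotient≤0 : ∀ K e e′ → e′ ℕ.< N → 1ℤ + K * Nℤ ≤ + e′ - + e → K ≤ 0ℤ
    quotient≤0 K e e′ e′<N h with ≤-or-> K 0ℤ
    ... | inj₁ K≤0 = K≤0
    ... | inj₂ 0<K =
      ⊥-elim (ℤP.<-asym ℤ.-<+ (<-from-diff {c = 0ℤ} {d = -1ℤ}
        (ℤP.+-mono-<-≤ (ℤP.+-mono-<-≤ (ℤP.+-mono-<-≤ (ℤ.+<+ e′<N) (*N-mono (<⇒+1≤ 0<K))) h) (ℤ.+≤+ {0} {e} ℕ.z≤n))
        (shape (+ e) (+ e′) K Nℤ)))
      where
      shape : ∀ e e′ k m → (m + k * m + (e′ - e) + e) - (e′ + (0ℤ + 1ℤ) * m + (1ℤ + k * m) + 0ℤ) ≡ -1ℤ - 0ℤ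
      shape = solve-∀

    quotient≤-1 : ∀ K e e′ → e′ ℕ.< e → 1ℤ + K * Nℤ ≤ + e′ - + e → K ≤ -1ℤ
    quotient≤-1 K e e′ e′<e h with ≤-or-> K -1ℤ
    ... | inj₁ K≤-1 = K≤-1
    ... | inj₂ -1<K =
      ⊥-elim (ℤP.≤⇒≯ (≤-from-diff {c = 0ℤ} {d = -[1+ 1 ]}
        (ℤP.+-mono-≤ (ℤP.+-mono-≤ h (*N-mono (<⇒+1≤ -1<K))) (<⇒+1≤ (ℤ.+<+ e′<e)))
        (shape (+ e) (+ e′) K Nℤ)) ℤ.-<+)
      where
      shape : ∀ e e′ k m → (e′ - e + k * m + e) - (1ℤ + k * m + (-1ℤ + 1ℤ) * m + (e′ + 1ℤ)) ≡ -[1+ 1 ] - 0ℤ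
      shape = solve-∀

    quotient≥1 : ∀ K e e′ → e ℕ.< e′ → + e′ - + e < 1ℤ + K * Nℤ → 1ℤ ≤ K
    quotient≥1 K e e′ e<e′ h with ≤-or-> 1ℤ K
    ... | inj₁ 1≤K = 1≤K
    ... | inj₂ K<1 =
      ⊥-elim (ℤP.<-irrefl refl
        (<-from-diff {c = 0ℤ} {d = 0ℤ}
          (ℤP.+-mono-<-≤ (ℤP.+-mono-<-≤ h (<⇒+1≤ (ℤ.+<+ e<e′))) (*N-mono (ℤP.i<j⇒i≤pred[j] K<1)))
          (shape (+ e) (+ e′) K Nℤ)))
      where
      shape : ∀ e e′ k m → (1ℤ + k * m + e′ + (1ℤ - 1ℤ) * m) - (e′ - e + (e + 1ℤ) + k * m) ≡ 0ℤ - 0ℤ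
      shape = solve-∀

    quotient≥0 : ∀ K e e′ → e ℕ.< N → + e′ - + e < 1ℤ + K * Nℤ → 0ℤ ≤ K
    quotient≥0 K e e′ e<N h with ≤-or-> 0ℤ K
    ... | inj₁ 0≤K = 0≤K
    ... | inj₂ K<0 =
      ⊥-elim (ℤP.≤⇒≯ (≤-from-diff {c = 0ℤ} {d = -1ℤ}
        (ℤP.+-mono-≤ (ℤP.+-mono-≤ (ℤP.+-mono-≤ (<⇒+1≤ h) (*N-mono (ℤP.i<j⇒i≤pred[j] K<0))) (<⇒+1≤ (ℤ.+<+ e<N)))
                     (ℤ.+≤+ {0} {e′} ℕ.z≤n))
        (shape (+ e) (+ e′) K Nℤ)) ℤ.-<+)
      where
      shape : ∀ e e′ k m → (1ℤ + k * m + (0ℤ - 1ℤ) * m + m + e′) - (e′ - e + 1ℤ + k * m + (e + 1ℤ) + 0ℤ) ≡ -1ℤ - 0ℤ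
      shape = solve-∀

    divN-of-offset : ∀ q D → 0ℤ ≤ D → D < Nℤ → ∀ {z} → z ≡ q * Nℤ + D → divN z ≡ q
    divN-of-offset q D 0≤D D<N {z} z≡ = divN-bounds z q
      (subst (q * Nℤ ≤_) (sym z≡) (subst (_≤ q * Nℤ + D) (ℤP.+-identityʳ _) (ℤP.+-monoʳ-≤ (q * Nℤ) 0≤D)))
      (subst (_< q * Nℤ + Nℤ) (sym z≡) (ℤP.+-monoʳ-< (q * Nℤ) D<N))

    level : ∀ J k → J ℕ.< N → modN (1ℤ + + J + k * Nℤ - 1ℤ) ≡ J × divN (1ℤ + + J + k * Nℤ - 1ℤ) ≡ k
    level J k J<N = divmod-char _ J k J<N (shape (+ J) (k * Nℤ))
      where
      shape : ∀ a b → 1ℤ + a + b - 1ℤ ≡ a + b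
      shape = solve-∀

  module AffineWindows (n : ℕ) (n≥1 : 1 ℕ.≤ n) where
    open Residues n

    next : Fin N → ℕ
    next a = suc (toℕ a) ℕ.% N

    next-cases : ∀ a → (toℕ a ℕ.< n × next a ≡ suc (toℕ a)) ⊎ (toℕ a ≡ n × next a ≡ 0)
    next-cases a with ℕP.m≤n⇒m<n∨m≡n (ℕP.≤-pred (FP.toℕ<n a))
    ... | inj₁ lt = inj₁ (lt , ℕD.m<n⇒m%n≡m (ℕ.s≤s lt))
    ... | inj₂ eq = inj₂ (eq , trans (cong (λ k → suc k ℕ.% N) eq) (ℕD.n%n≡0 N))

    next<N : ∀ a → next a ℕ.< N
    next<N a = ℕD.m%n<n (suc (toℕ a)) N

    next≢ : ∀ a → next a ≢ toℕ a
    next≢ a e with next-cases a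
    ... | inj₁ (_ , q) = ℕP.<-irrefl (trans (sym e) q) (ℕP.n<1+n (toℕ a))
    ... | inj₂ (p , q) = ℕP.<⇒≢ n≥1 (sym (trans (sym p) (trans (sym e) q)))

    next-injective : ∀ a b → next a ≡ next b → a ≡ b
    next-injective a b h with next-cases a | next-cases b
    ... | inj₁ (_ , p) | inj₁ (_ , q) = FP.toℕ-injective (ℕP.suc-injective (trans (sym p) (trans h q)))
    ... | inj₁ (_ , p) | inj₂ (_ , q) = ⊥-elim (ℕP.0≢1+n (trans (sym q) (trans (sym h) p)))
    ... | inj₂ (_ , p) | inj₁ (_ , q) = ⊥-elim (ℕP.0≢1+n (trans (sym p) (trans h q)))
    ... | inj₂ (p , _) | inj₂ (q , _) = FP.toℕ-injective (trans p (sym q))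

    previous : ℕ → Fin N
    previous zero = F.fromℕ n
    previous (suc k) with k ℕ.<? N
    ... | yes k<N = F.fromℕ< k<N
    ... | no _ = F.zero

    next-previous : ∀ k → k ℕ.< N → next (previous k) ≡ k
    next-previous zero h = trans (cong (λ x → suc x ℕ.% N) (FP.toℕ-fromℕ n)) (ℕD.n%n≡0 N)
    next-previous (suc k) h with k ℕ.<? N
    ... | yes k<N = trans (cong (λ x → suc x ℕ.% N) (FP.toℕ-fromℕ< k<N)) (ℕD.m<n⇒m%n≡m h)
    ... | no k≮N = ⊥-elim (k≮N (ℕP.<-trans (ℕP.n<1+n k) h))

    gen-up : ∀ (a : Fin N) t → modN t ≡ toℕ a → gen a t ≡ t + 1ℤ
    gen-up a t e rewrite dec-true (modN t ℕ.≟ toℕ a) e = refl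

    gen-down : ∀ (a : Fin N) t → modN t ≢ toℕ a → modN t ≡ next a → gen a t ≡ t - 1ℤ
    gen-down a t ne e rewrite dec-false (modN t ℕ.≟ toℕ a) ne | dec-true (modN t ℕ.≟ next a) e = refl

    gen-fix : ∀ (a : Fin N) t → modN t ≢ toℕ a → modN t ≢ next a → gen a t ≡ t
    gen-fix a t ne ne′ rewrite dec-false (modN t ℕ.≟ toℕ a) ne | dec-false (modN t ℕ.≟ next a) ne′ = refl

    modN-up : ∀ (a : Fin N) t → modN t ≡ toℕ a → modN (t + 1ℤ) ≡ next a
    modN-up a t e with modN-suc t | next-cases a
    ... | inj₁ (_ , p , _) | inj₁ (_ , q) = trans p (trans (cong suc e) (sym q))
    ... | inj₁ (lt , _ , _) | inj₂ (p , _) = ⊥-elim (ℕP.<-irrefl (trans e p) lt)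
    ... | inj₂ (p , _ , _) | inj₁ (lt , _) = ⊥-elim (ℕP.<-irrefl (trans (sym e) p) lt)
    ... | inj₂ (_ , p , _) | inj₂ (_ , q) = trans p (sym q)

    modN-down : ∀ (a : Fin N) t → modN t ≡ next a → modN (t - 1ℤ) ≡ toℕ a
    modN-down a t e with modN-pred t | next-cases a
    ... | inj₁ (_ , p , _) | inj₁ (_ , q) = ℕP.suc-injective (trans (sym p) (trans e q))
    ... | inj₁ (_ , p , _) | inj₂ (_ , q) = ⊥-elim (ℕP.0≢1+n (trans (sym q) (trans (sym e) p)))
    ... | inj₂ (_ , p , _) | inj₁ (_ , q) = ⊥-elim (ℕP.0≢1+n (trans (sym p) (trans e q)))
    ... | inj₂ (p , _ , _) | inj₂ (q , _) = trans p (sym q)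

    data GenCase (a : Fin N) (t : ℤ) : Set where
      raised : modN t ≡ toℕ a → gen a t ≡ t + 1ℤ → modN (gen a t) ≡ next a → GenCase a t
      lowered : modN t ≡ next a → gen a t ≡ t - 1ℤ → modN (gen a t) ≡ toℕ a → GenCase a t
      fixed : modN t ≢ toℕ a → modN t ≢ next a → gen a t ≡ t → GenCase a t

    genCase : ∀ a t → GenCase a t
    genCase a t with modN t ℕ.≟ toℕ a
    ... | yes e = raised e (gen-up a t e) (subst (λ x → modN x ≡ next a) (sym (gen-up a t e)) (modN-up a t e))
    ... | no ne with modN t ℕ.≟ next a
    ...   | yes e = lowered e (gen-down a t ne e) (subst (λ x → modN x ≡ toℕ a) (sym (gen-down a t ne e)) (modN-down a t e))
    ...   | no ne′ = fixed ne ne′ (gen-fix a t ne ne′)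

    gen-involutive : ∀ (a : Fin N) t → gen a (gen a t) ≡ t
    gen-involutive a t with genCase a t
    ... | raised e g _ rewrite g with genCase a (t + 1ℤ)
    ...   | raised e′ _ _ = ⊥-elim (next≢ a (trans (sym (modN-up a t e)) e′))
    ...   | lowered _ g′ _ = trans g′ (z+1-1≡z t)
    ...   | fixed _ ne′ _ = ⊥-elim (ne′ (modN-up a t e))
    gen-involutive a t | lowered e g _ rewrite g with genCase a (t - 1ℤ)
    ...   | raised _ g′ _ = trans g′ (z-1+1≡z t)
    ...   | lowered e′ _ _ = ⊥-elim (next≢ a (trans (sym e′) (modN-down a t e)))
    ...   | fixed ne _ _ = ⊥-elim (ne (modN-down a t e))
    gen-involutive a t | fixed _ _ g = trans (cong (gen a) g) g

    gen-periodic : ∀ (a : Fin N) t q → gen a (t + q * Nℤ) ≡ gen a t + q * Nℤ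
    gen-periodic a t q = by-case (genCase a t)
      where
      same-res : modN (t + q * Nℤ) ≡ modN t
      same-res = modN-shift t q
      swap : ∀ t c d → t + c + d ≡ t + d + c
      swap = solve-∀
      by-case : GenCase a t → gen a (t + q * Nℤ) ≡ gen a t + q * Nℤ
      by-case (raised e g _) =
        trans (gen-up a (t + q * Nℤ) (trans same-res e)) (trans (swap t (q * Nℤ) 1ℤ) (cong (_+ q * Nℤ) (sym g)))
      by-case (lowered e g _) =
        trans (gen-down a (t + q * Nℤ) (λ h → next≢ a (trans (sym e) (trans (sym same-res) h))) (trans same-res e))
              (trans (swap t (q * Nℤ) -1ℤ) (cong (_+ q * Nℤ) (sym g)))
      by-case (fixed ne ne′ g) =
        trans (gen-fix a (t + q * Nℤ) (ne ∘ trans (sym same-res)) (ne′ ∘ trans (sym same-res)))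
              (cong (_+ q * Nℤ) (sym g))

    Window : Set
    Window = Fin N → ℤ

    extend : Window → ℤ → ℤ
    extend W t = W (rem n t) + quo n t * Nℤ

    idWindow : Window
    idWindow r = + suc (toℕ r)

    act : Fin N → Window → Window
    act a W r = gen a (W r)

    window : Word n → Window
    window [] = idWindow
    window (a ∷ ws) = act a (window ws)

    eval≡extend-window : ∀ ws t → eval ws t ≡ extend (window ws) t
    eval≡extend-window [] t = sym (begin
      + suc (toℕ (rem n t)) + quo n t * Nℤ     ≡⟨ cong (λ k → + suc k + quo n t * Nℤ) (FP.toℕ-fromℕ< _) ⟩
      1ℤ + + modN (t - 1ℤ) + divN (t - 1ℤ) * Nℤ ≡⟨ shape (+ modN (t - 1ℤ)) (divN (t - 1ℤ) * Nℤ) ⟩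
      + modN (t - 1ℤ) + divN (t - 1ℤ) * Nℤ + 1ℤ ≡⟨ cong (_+ 1ℤ) (sym (modN+divN (t - 1ℤ))) ⟩
      t - 1ℤ + 1ℤ                                ≡⟨ z-1+1≡z t ⟩
      t                                          ∎)
      where
      open ≡-Reasoning
      shape : ∀ m q → 1ℤ + m + q ≡ m + q + 1ℤ
      shape = solve-∀
    eval≡extend-window (a ∷ ws) t =
      trans (cong (gen a) (eval≡extend-window ws t)) (gen-periodic a (window ws (rem n t)) (quo n t))

    extend-at : ∀ W r → extend W (+ suc (toℕ r)) ≡ W r
    extend-at W r =
      trans (cong₂ (λ x y → W x + y * Nℤ) rem≡r (cong +_ (ℕD.m<n⇒m/n≡0 (FP.toℕ<n r)))) (ℤP.+-identityʳ (W r))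
      where
      rem≡r : rem n (+ suc (toℕ r)) ≡ r
      rem≡r = FP.toℕ-injective (trans (FP.toℕ-fromℕ< _) (modN-small (toℕ r) (FP.toℕ<n r)))

    𝟙≤ : Fin N → Fin N → ℤ
    𝟙≤ r i = ϖ' {n} (suc (toℕ i)) r

    ϖ'-yes : ∀ J (c : Fin N) → toℕ c ℕ.< J → ϖ' {n} J c ≡ 1ℤ
    ϖ'-yes J c h rewrite dec-true (suc (toℕ c) ℕ.≤? J) h = refl

    ϖ'-no : ∀ J (c : Fin N) → J ℕ.≤ toℕ c → ϖ' {n} J c ≡ 0ℤ
    ϖ'-no J c h rewrite dec-false (suc (toℕ c) ℕ.≤? J) (ℕP.<⇒≱ (ℕ.s≤s h)) = refl

    𝟙≤-yes : ∀ r i → toℕ r ℕ.≤ toℕ i → 𝟙≤ r i ≡ 1ℤ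
    𝟙≤-yes r i h = ϖ'-yes (suc (toℕ i)) r (ℕ.s≤s h)

    𝟙≤-no : ∀ r i → toℕ i ℕ.< toℕ r → 𝟙≤ r i ≡ 0ℤ
    𝟙≤-no r i h = ϖ'-no (suc (toℕ i)) r h

    ifZero : ℕ → ℤ → ℤ
    ifZero zero x = x
    ifZero (suc _) x = 0ℤ

    ifZero-≢0 : ∀ k x → k ≢ 0 → ifZero k x ≡ 0ℤ
    ifZero-≢0 zero x ne = ⊥-elim (ne refl)
    ifZero-≢0 (suc k) x ne = refl

    -- With π = extend W, the r-th summand of count W i j counts the t ≤ i + 1 with t ≡ r + 1 (mod N)
    -- and π t ≥ j, so count W i j = #{t ≤ i + 1 ∣ π t ≥ j} and hits W i j = #{t ≤ i + 1 ∣ π t ≡ j}.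
    countAt : Window → Fin N → ℤ → Fin N → ℤ
    countAt W i j r = (divN (W r - j) + 𝟙≤ r i) ⁺

    hitAt : Window → Fin N → ℤ → Fin N → ℤ
    hitAt W i j r = ifZero (modN (W r - j)) 𝟙[ divN (W r - j) + 𝟙≤ r i >0]

    count : Window → Fin N → ℤ → ℤ
    count W i j = ∑ (countAt W i j)

    hits : Window → Fin N → ℤ → ℤ
    hits W i j = ∑ (hitAt W i j)

    countAt-step : ∀ z b → (divN z + b) ⁺ ≡ (divN (z - 1ℤ) + b) ⁺ + ifZero (modN z) 𝟙[ divN z + b >0]
    countAt-step z b with modN-pred z
    ... | inj₁ (_ , r≡ , q≡) rewrite r≡ | q≡ = sym (ℤP.+-identityʳ _)
    ... | inj₂ (_ , r≡0 , q≡) rewrite r≡0 = begin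
      (divN z + b) ⁺                                       ≡⟨ cong (λ x → (x + b) ⁺) (sym q≡) ⟩
      (q + 1ℤ + b) ⁺                                       ≡⟨ cong _⁺ (shape q b) ⟩
      (q + b + 1ℤ) ⁺                                       ≡⟨ ⁺-+1 (q + b) ⟩
      (q + b) ⁺ + 𝟙[ q + b + 1ℤ >0]                        ≡⟨ cong (λ x → (q + b) ⁺ + 𝟙[ x >0]) (sym (shape q b)) ⟩
      (q + b) ⁺ + 𝟙[ q + 1ℤ + b >0]                        ≡⟨ cong (λ x → (q + b) ⁺ + 𝟙[ x + b >0]) q≡ ⟩
      (q + b) ⁺ + 𝟙[ divN z + b >0]                        ∎
      where
      open ≡-Reasoning
      q : ℤ
      q = divN (z - 1ℤ)
      shape : ∀ a b → a + 1ℤ + b ≡ a + b + 1ℤ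
      shape = solve-∀

    count-step : ∀ W i j → count W i j ≡ count W i (j + 1ℤ) + hits W i j
    count-step W i j =
      trans (∑-cong λ r → trans (countAt-step (W r - j) (𝟙≤ r i))
                                (cong (λ x → (divN x + 𝟙≤ r i) ⁺ + hitAt W i j r) (shape (W r) j)))
            (∑-+ (countAt W i (j + 1ℤ)) (hitAt W i j))
      where
      shape : ∀ a j → a - j - 1ℤ ≡ a - (j + 1ℤ)
      shape = solve-∀

    count-act-off : ∀ a W i j → modN j ≢ next a → count (act a W) i j ≡ count W i j
    count-act-off a W i j ne = ∑-cong λ r → cong (λ x → (x + 𝟙≤ r i) ⁺) (same-quotient (W r))
      where
      same-quotient : ∀ t → divN (gen a t - j) ≡ divN (t - j)
      same-quotient t with genCase a t
      ... | raised e g _ rewrite g =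
        trans (sym (divN-pred (t + 1ℤ - j) (modN-diff≢0 (t + 1ℤ) j (λ h → ne (trans (sym h) (modN-up a t e))))))
              (cong divN (shape t j))
        where
        shape : ∀ t j → t + 1ℤ - j - 1ℤ ≡ t - j
        shape = solve-∀
      ... | lowered e g _ rewrite g =
        trans (cong divN (shape t j)) (divN-pred (t - j) (modN-diff≢0 t j (λ h → ne (trans (sym h) e))))
        where
        shape : ∀ t j → t - 1ℤ - j ≡ t - j - 1ℤ
        shape = solve-∀
      ... | fixed _ _ g rewrite g = refl

    countAt-act-next : ∀ a t j b → modN j ≡ next a →
      (divN (gen a t - j) + b) ⁺ ≡ (divN (t - (j + 1ℤ)) + b) ⁺ + ifZero (modN (t - (j - 1ℤ))) 𝟙[ divN (t - (j - 1ℤ)) + b >0]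
    countAt-act-next a t j b j≡next with genCase a t
    ... | raised t≡a g _ rewrite g =
      trans (cong (λ x → (divN x + b) ⁺) (t+1-j t j))
        (trans (countAt-step (t - (j - 1ℤ)) b)
          (cong (λ x → (x + b) ⁺ + ifZero (modN (t - (j - 1ℤ))) 𝟙[ divN (t - (j - 1ℤ)) + b >0])
            (trans (cong divN (t-[j-1]-1 t j))
              (trans (sym (divN-pred (t - j) (modN-diff≢0 t j (λ h → next≢ a (trans (sym j≡next) (trans (sym h) t≡a))))))
                     (cong divN (sym (t-j-1 t j)))))))
      where
      t+1-j : ∀ t j → t + 1ℤ - j ≡ t - (j - 1ℤ)
      t+1-j = solve-∀
      t-[j-1]-1 : ∀ t j → t - (j - 1ℤ) - 1ℤ ≡ t - j
      t-[j-1]-1 = solve-∀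
      t-j-1 : ∀ t j → t - (j + 1ℤ) ≡ t - j - 1ℤ
      t-j-1 = solve-∀
    ... | lowered t≡next g _ rewrite g =
      trans (cong (λ x → (divN x + b) ⁺) (t-1-j t j))
        (sym (trans (cong (λ u → (divN (t - (j + 1ℤ)) + b) ⁺ + u)
                          (ifZero-≢0 _ _ (modN-diff≢0 t (j - 1ℤ)
                            (λ h → next≢ a (trans (sym t≡next) (trans h (modN-down a j j≡next)))))))
                    (ℤP.+-identityʳ _)))
      where
      t-1-j : ∀ t j → t - 1ℤ - j ≡ t - (j + 1ℤ)
      t-1-j = solve-∀
    ... | fixed t≢a t≢next g rewrite g =
      trans (cong (λ x → (x + b) ⁺)
                  (trans (sym (divN-pred (t - j) (modN-diff≢0 t j (λ h → t≢next (trans h j≡next)))))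
                         (cong divN (sym (t-j-1 t j)))))
        (sym (trans (cong (λ u → (divN (t - (j + 1ℤ)) + b) ⁺ + u)
                          (ifZero-≢0 _ _ (modN-diff≢0 t (j - 1ℤ) (λ h → t≢a (trans h (modN-down a j j≡next))))))
                    (ℤP.+-identityʳ _)))
      where
      t-j-1 : ∀ t j → t - (j + 1ℤ) ≡ t - j - 1ℤ
      t-j-1 = solve-∀

    count-act-next : ∀ a W i j → modN j ≡ next a → count (act a W) i j ≡ count W i (j + 1ℤ) + hits W i (j - 1ℤ)
    count-act-next a W i j j≡next =
      trans (∑-cong λ r → countAt-act-next a (W r) j (𝟙≤ r i) j≡next)
            (∑-+ (countAt W i (j + 1ℤ)) (hitAt W i (j - 1ℤ)))

    -- The window [π 1, …, π N] of an element π of the affine symmetric group; slot k is the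
    -- position whose value has residue k.
    record IsAffineWindow (W : Window) : Set where
      field
        slotOf : ℕ → Fin N
        slotOf-res : ∀ k → k ℕ.< N → modN (W (slotOf k)) ≡ k
        res-injective : ∀ r x → modN (W r) ≡ modN (W x) → r ≡ x
        sum≡ : ∑ W ≡ ∑ idWindow

    module OnAffineWindow {W : Window} (isAffine : IsAffineWindow W) where
      open IsAffineWindow isAffine public

      slotOfValue : ℤ → Fin N
      slotOfValue j = slotOf (modN j)

      slotOfValue-res : ∀ j → modN (W (slotOfValue j)) ≡ modN j
      slotOfValue-res j = slotOf-res (modN j) (modN<N j)

      slotOfValue-unique : ∀ r j → modN (W r) ≡ modN j → r ≡ slotOfValue j
      slotOfValue-unique r j e = res-injective r (slotOfValue j) (trans e (sym (slotOfValue-res j)))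

      -- extend W (preimage j + 1) ≡ j
      preimage : ℤ → ℤ
      preimage j = + toℕ (slotOfValue j) + (j - W (slotOfValue j))

      preimage≡ : ∀ j → preimage j ≡ + toℕ (slotOfValue j) - divN (W (slotOfValue j) - j) * Nℤ
      preimage≡ j = begin
        + e + (j - w)           ≡⟨ shape (+ e) w j ⟩
        + e - (w - j)           ≡⟨ cong (λ u → + e - u) (modN+divN (w - j)) ⟩
        + e - (+ modN (w - j) + q * Nℤ) ≡⟨ cong (λ k → + e - (+ k + q * Nℤ)) (modN-diff≡0 w j (slotOfValue-res j)) ⟩
        + e - (0ℤ + q * Nℤ)     ≡⟨ cong (λ u → + e - u) (ℤP.+-identityˡ (q * Nℤ)) ⟩
        + e - q * Nℤ            ∎
        where
        open ≡-Reasoning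
        e : ℕ
        e = toℕ (slotOfValue j)
        w q : ℤ
        w = W (slotOfValue j)
        q = divN (w - j)
        shape : ∀ e w j → e + (j - w) ≡ e - (w - j)
        shape = solve-∀

      hits≡ : ∀ i j → hits W i j ≡ 𝟙[ divN (W (slotOfValue j) - j) + 𝟙≤ (slotOfValue j) i >0]
      hits≡ i j = trans only-slot (cong (λ k → ifZero k 𝟙[ divN (W e - j) + 𝟙≤ e i >0]) (modN-diff≡0 (W e) j (slotOfValue-res j)))
        where
        e : Fin N
        e = slotOfValue j
        only-slot : hits W i j ≡ hitAt W i j (slotOfValue j)
        only-slot = ∑-single (slotOfValue j) λ r r≢ →
          ifZero-≢0 (modN (W r - j)) 𝟙[ divN (W r - j) + 𝟙≤ r i >0] (λ h → r≢ (slotOfValue-unique r j (modN-diff≡0⇒≡ (W r) j h)))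

      hits-≤ : ∀ i j → preimage j ≤ + toℕ i → hits W i j ≡ 1ℤ
      hits-≤ i j h rewrite hits≡ i j with ℕP.≤-<-connex (toℕ (slotOfValue j)) (toℕ i)
      ... | inj₁ e≤i rewrite 𝟙≤-yes (slotOfValue j) i e≤i with ≤-or-> 0ℤ (divN (W (slotOfValue j) - j))
      ...   | inj₁ q≥0 = 𝟙-of-pos _ (0≤⇒0<+1 q≥0)
      ...   | inj₂ q<0 = ⊥-elim (ℤP.≤⇒≯ h (subst (+ toℕ i <_) (sym (preimage≡ j))
                                           (shifted>-of-neg (toℕ (slotOfValue j)) (toℕ i) _ (FP.toℕ<n i) q<0)))
      hits-≤ i j h | inj₂ i<e rewrite 𝟙≤-no (slotOfValue j) i i<e with ≤-or-> (divN (W (slotOfValue j) - j)) 0ℤ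
      ...   | inj₂ q>0 = 𝟙-of-pos _ (subst (0ℤ <_) (sym (ℤP.+-identityʳ _)) q>0)
      ...   | inj₁ q≤0 = ⊥-elim (ℤP.≤⇒≯ h (subst (+ toℕ i <_) (sym (preimage≡ j))
                                           (shifted>-of-nonpos (toℕ (slotOfValue j)) (toℕ i) _ i<e q≤0)))

      hits-> : ∀ i j → + toℕ i < preimage j → hits W i j ≡ 0ℤ
      hits-> i j h rewrite hits≡ i j with ℕP.≤-<-connex (toℕ (slotOfValue j)) (toℕ i)
      ... | inj₁ e≤i rewrite 𝟙≤-yes (slotOfValue j) i e≤i with ≤-or-> 0ℤ (divN (W (slotOfValue j) - j))
      ...   | inj₂ q<0 = 𝟙-of-nonpos _ (<⇒+1≤ q<0)
      ...   | inj₁ q≥0 = ⊥-elim (ℤP.≤⇒≯ (subst (_≤ + toℕ i) (sym (preimage≡ j))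
                                             (shifted≤-of-≤ (toℕ (slotOfValue j)) (toℕ i) _ e≤i q≥0)) h)
      hits-> i j h | inj₂ i<e rewrite 𝟙≤-no (slotOfValue j) i i<e with ≤-or-> (divN (W (slotOfValue j) - j)) 0ℤ
      ...   | inj₁ q≤0 = 𝟙-of-nonpos _ (subst (_≤ 0ℤ) (sym (ℤP.+-identityʳ _)) q≤0)
      ...   | inj₂ q>0 = ⊥-elim (ℤP.≤⇒≯ (subst (_≤ + toℕ i) (sym (preimage≡ j))
                                             (shifted≤-of-pos (toℕ (slotOfValue j)) (toℕ i) _ (FP.toℕ<n (slotOfValue j)) q>0)) h)

      hits-bit : ∀ i j → Bit (hits W i j)
      hits-bit i j with ≤-or-> (preimage j) (+ toℕ i)
      ... | inj₁ h = inj₂ (hits-≤ i j h)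
      ... | inj₂ h = inj₁ (hits-> i j h)

      slot slot⁺ : Fin N → Fin N
      slot a = slotOf (toℕ a)
      slot⁺ a = slotOf (next a)

      -- Equivalently π⁻¹ a < π⁻¹ (a + 1), i.e. s_a π > π in the Bruhat order.
      LeftAscent LeftDescent : Fin N → Set
      LeftAscent a = W (slot⁺ a) - W (slot a) ≤ + toℕ (slot⁺ a) - + toℕ (slot a)
      LeftDescent a = + toℕ (slot⁺ a) - + toℕ (slot a) < W (slot⁺ a) - W (slot a)

      ascent-or-descent : ∀ a → LeftAscent a ⊎ LeftDescent a
      ascent-or-descent a = ≤-or-> _ _

      ascent⇒preimage< : ∀ a j → LeftAscent a → modN j ≡ next a → preimage (j - 1ℤ) < preimage j
      ascent⇒preimage< a j h j≡next rewrite j≡next | modN-down a j j≡next =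
        +1≤⇒< (≤-from-diff h (shape (+ toℕ (slot a)) (+ toℕ (slot⁺ a)) (W (slot a)) (W (slot⁺ a)) j))
        where
        shape : ∀ e e′ w w′ j → (e′ - e) - (w′ - w) ≡ (e′ + (j - w′)) - (e + (j - 1ℤ - w) + 1ℤ)
        shape = solve-∀

      descent⇒preimage≥ : ∀ a j → LeftDescent a → modN j ≡ next a → preimage j ≤ preimage (j - 1ℤ)
      descent⇒preimage≥ a j h j≡next rewrite j≡next | modN-down a j j≡next =
        ≤-from-diff (<⇒+1≤ h) (shape (+ toℕ (slot a)) (+ toℕ (slot⁺ a)) (W (slot a)) (W (slot⁺ a)) j)
        where
        shape : ∀ e e′ w w′ j → (w′ - w) - (e′ - e + 1ℤ) ≡ (e + (j - 1ℤ - w)) - (e′ + (j - w′))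
        shape = solve-∀

      ascent⇒hits≤ : ∀ a → LeftAscent a → ∀ i j → modN j ≡ next a → hits W i j ≤ hits W i (j - 1ℤ)
      ascent⇒hits≤ a h i j j≡next with ≤-or-> (preimage j) (+ toℕ i)
      ... | inj₁ le = ℤP.≤-reflexive (trans (hits-≤ i j le)
                        (sym (hits-≤ i (j - 1ℤ) (ℤP.<⇒≤ (ℤP.<-≤-trans (ascent⇒preimage< a j h j≡next) le)))))
      ... | inj₂ gt = subst (_≤ hits W i (j - 1ℤ)) (sym (hits-> i j gt)) (bit-nonneg (hits-bit i (j - 1ℤ)))

      descent⇒hits≥ : ∀ a → LeftDescent a → ∀ i j → modN j ≡ next a → hits W i (j - 1ℤ) ≤ hits W i j
      descent⇒hits≥ a h i j j≡next with ≤-or-> (preimage (j - 1ℤ)) (+ toℕ i)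
      ... | inj₁ le = ℤP.≤-reflexive (trans (hits-≤ i (j - 1ℤ) le)
                        (sym (hits-≤ i j (ℤP.≤-trans (descent⇒preimage≥ a j h j≡next) le))))
      ... | inj₂ gt = subst (_≤ hits W i j) (sym (hits-> i (j - 1ℤ) gt)) (bit-nonneg (hits-bit i j))

    _≼_ : Window → Window → Set
    U ≼ V = ∀ i j → count U i j ≤ count V i j

    ≼-trans : ∀ {U V X} → U ≼ V → V ≼ X → U ≼ X
    ≼-trans U≼V V≼X i j = ℤP.≤-trans (U≼V i j) (V≼X i j)

    ≼-refl : ∀ {U} → U ≼ U
    ≼-refl i j = ℤP.≤-refl

    count-step₂ : ∀ W i j → count W i (j - 1ℤ) ≡ count W i (j + 1ℤ) + hits W i j + hits W i (j - 1ℤ)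
    count-step₂ W i j =
      trans (count-step W i (j - 1ℤ))
            (cong (_+ hits W i (j - 1ℤ)) (trans (cong (count W i) (z-1+1≡z j)) (count-step W i j)))

    -- In the lemmas below A, B are the counts at j + 1 and x, y resp. p, q the hits at j resp. j - 1.
    lift-arith : ∀ {A B x y p q} → A ≤ B → A + x + p ≤ B + y + q → y ≤ q →
                 Bit x → Bit y → Bit p → Bit q → A + p ≤ B + q
    lift-arith A≤B _ _ _ _ (inj₁ refl) bq = ℤP.+-mono-≤ A≤B (bit-nonneg bq)
    lift-arith A≤B _ _ _ _ (inj₂ refl) (inj₂ refl) = ℤP.+-mono-≤ A≤B ℤP.≤-refl
    lift-arith {A} {B} {x} _ sum≤ y≤q bx by (inj₂ refl) (inj₁ refl) with bit≤0⇒≡0 by y≤q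
    ... | refl = ≤-from-diff (ℤP.+-mono-≤ sum≤ (bit-nonneg bx)) (shape A B x)
      where
      shape : ∀ A B x → (B + 0ℤ + 0ℤ + x) - (A + x + 1ℤ + 0ℤ) ≡ (B + 0ℤ) - (A + 1ℤ)
      shape = solve-∀

    descents-arith : ∀ {A B x y p q} → A ≤ B → A + x ≤ B + y → A + x + p ≤ B + y + q → p ≤ x → q ≤ y →
                     Bit x → Bit y → Bit p → Bit q → A + p ≤ B + q
    descents-arith A≤B _ _ _ _ _ _ (inj₁ refl) bq = ℤP.+-mono-≤ A≤B (bit-nonneg bq)
    descents-arith A≤B _ _ _ _ _ _ (inj₂ refl) (inj₂ refl) = ℤP.+-mono-≤ A≤B ℤP.≤-refl
    descents-arith {A} {B} _ A+x≤B+y sum≤ p≤x _ bx by (inj₂ refl) (inj₁ refl) with bit≥1⇒≡1 bx p≤x | by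
    ... | refl | inj₁ refl = A+x≤B+y
    ... | refl | inj₂ refl = ≤-from-diff sum≤ (shape A B)
      where
      shape : ∀ A B → (B + 1ℤ + 0ℤ) - (A + 1ℤ + 1ℤ) ≡ (B + 0ℤ) - (A + 1ℤ)
      shape = solve-∀

    ascent-descent-arith : ∀ {A B x y p q} → A ≤ B → A + x + p ≤ B + y + q → x ≤ p → q ≤ y →
                           Bit x → Bit y → Bit p → Bit q → A + x ≤ B + q
    ascent-descent-arith A≤B _ _ _ (inj₁ refl) _ _ bq = ℤP.+-mono-≤ A≤B (bit-nonneg bq)
    ascent-descent-arith A≤B _ _ _ (inj₂ refl) _ _ (inj₂ refl) = ℤP.+-mono-≤ A≤B ℤP.≤-refl
    ascent-descent-arith {A} {B} _ sum≤ x≤p _ (inj₂ refl) by bp (inj₁ refl) with bit≥1⇒≡1 bp x≤p | by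
    ... | refl | inj₁ refl = ≤-from-diff (ℤP.+-mono-≤ sum≤ (ℤ.+≤+ {0} {1} ℕ.z≤n)) (shape A B)
      where
      shape : ∀ A B → (B + 0ℤ + 0ℤ + 1ℤ) - (A + 1ℤ + 1ℤ + 0ℤ) ≡ (B + 0ℤ) - (A + 1ℤ)
      shape = solve-∀
    ... | refl | inj₂ refl = ≤-from-diff sum≤ (shape A B)
      where
      shape : ∀ A B → (B + 1ℤ + 0ℤ) - (A + 1ℤ + 1ℤ) ≡ (B + 0ℤ) - (A + 1ℤ)
      shape = solve-∀

    module _ {U V : Window} (u : IsAffineWindow U) (v : IsAffineWindow V) (a : Fin N) where
      private
        module U = OnAffineWindow u
        module V = OnAffineWindow v

        at-j-1 : U ≼ V → ∀ i j → count U i (j + 1ℤ) + hits U i j + hits U i (j - 1ℤ)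
                                ≤ count V i (j + 1ℤ) + hits V i j + hits V i (j - 1ℤ)
        at-j-1 U≼V i j = subst₂ _≤_ (count-step₂ U i j) (count-step₂ V i j) (U≼V i (j - 1ℤ))

      ≼-lift : V.LeftAscent a → U ≼ V → act a U ≼ act a V
      ≼-lift asc U≼V i j with modN j ℕ.≟ next a
      ... | no j≢ = subst₂ _≤_ (sym (count-act-off a U i j j≢)) (sym (count-act-off a V i j j≢)) (U≼V i j)
      ... | yes j≡ =
        subst₂ _≤_ (sym (count-act-next a U i j j≡)) (sym (count-act-next a V i j j≡))
          (lift-arith (U≼V i (j + 1ℤ)) (at-j-1 U≼V i j) (V.ascent⇒hits≤ a asc i j j≡)
                      (U.hits-bit i j) (V.hits-bit i j) (U.hits-bit i (j - 1ℤ)) (V.hits-bit i (j - 1ℤ)))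

      ≼-lift-descents : U.LeftDescent a → V.LeftDescent a → U ≼ V → act a U ≼ act a V
      ≼-lift-descents descU descV U≼V i j with modN j ℕ.≟ next a
      ... | no j≢ = subst₂ _≤_ (sym (count-act-off a U i j j≢)) (sym (count-act-off a V i j j≢)) (U≼V i j)
      ... | yes j≡ =
        subst₂ _≤_ (sym (count-act-next a U i j j≡)) (sym (count-act-next a V i j j≡))
          (descents-arith (U≼V i (j + 1ℤ)) (subst₂ _≤_ (count-step U i j) (count-step V i j) (U≼V i j))
                          (at-j-1 U≼V i j) (U.descent⇒hits≥ a descU i j j≡) (V.descent⇒hits≥ a descV i j j≡)
                          (U.hits-bit i j) (V.hits-bit i j) (U.hits-bit i (j - 1ℤ)) (V.hits-bit i (j - 1ℤ)))

      ≼-act-descent : U.LeftAscent a → V.LeftDescent a → U ≼ V → U ≼ act a V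
      ≼-act-descent ascU descV U≼V i j with modN j ℕ.≟ next a
      ... | no j≢ = subst (count U i j ≤_) (sym (count-act-off a V i j j≢)) (U≼V i j)
      ... | yes j≡ =
        subst₂ _≤_ (sym (count-step U i j)) (sym (count-act-next a V i j j≡))
          (ascent-descent-arith (U≼V i (j + 1ℤ)) (at-j-1 U≼V i j)
                                (U.ascent⇒hits≤ a ascU i j j≡) (V.descent⇒hits≥ a descV i j j≡)
                                (U.hits-bit i j) (V.hits-bit i j) (U.hits-bit i (j - 1ℤ)) (V.hits-bit i (j - 1ℤ)))

    ≼-act-ascent : ∀ {V} (v : IsAffineWindow V) a → OnAffineWindow.LeftAscent v a → V ≼ act a V
    ≼-act-ascent {V} v a asc i j with modN j ℕ.≟ next a
    ... | no j≢ = ℤP.≤-reflexive (sym (count-act-off a V i j j≢))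
    ... | yes j≡ =
      subst₂ _≤_ (sym (count-step V i j)) (sym (count-act-next a V i j j≡))
        (ℤP.+-monoʳ-≤ (count V i (j + 1ℤ)) (OnAffineWindow.ascent⇒hits≤ v a asc i j j≡))

    module ActOnAffineWindow {W : Window} (isAffine : IsAffineWindow W) (a : Fin N) where
      open OnAffineWindow isAffine

      slot-res : modN (W (slot a)) ≡ toℕ a
      slot-res = slotOf-res (toℕ a) (FP.toℕ<n a)

      slot⁺-res : modN (W (slot⁺ a)) ≡ next a
      slot⁺-res = slotOf-res (next a) (next<N a)

      slot≢slot⁺ : slot a ≢ slot⁺ a
      slot≢slot⁺ h = next≢ a (trans (sym slot⁺-res) (trans (cong (modN ∘ W) (sym h)) slot-res))

      act-slot : act a W (slot a) ≡ W (slot a) + 1ℤ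
      act-slot = gen-up a (W (slot a)) slot-res

      act-slot⁺ : act a W (slot⁺ a) ≡ W (slot⁺ a) - 1ℤ
      act-slot⁺ = gen-down a (W (slot⁺ a)) (λ h → next≢ a (trans (sym slot⁺-res) h)) slot⁺-res

      act-other : ∀ x → x ≢ slot a → x ≢ slot⁺ a → act a W x ≡ W x
      act-other x x≢ x≢⁺ =
        gen-fix a (W x) (λ h → x≢ (res-injective x (slot a) (trans h (sym slot-res))))
                        (λ h → x≢⁺ (res-injective x (slot⁺ a) (trans h (sym slot⁺-res))))

      slotOf′ : ℕ → Fin N
      slotOf′ k with k ℕ.≟ toℕ a
      ... | yes _ = slot⁺ a
      ... | no _ with k ℕ.≟ next a
      ...   | yes _ = slot a
      ...   | no _ = slotOf k

      slotOf′-res : ∀ k → k ℕ.< N → modN (act a W (slotOf′ k)) ≡ k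
      slotOf′-res k k<N with k ℕ.≟ toℕ a
      ... | yes refl = by-case (genCase a (W (slot⁺ a)))
        where
        by-case : GenCase a (W (slot⁺ a)) → modN (gen a (W (slot⁺ a))) ≡ toℕ a
        by-case (raised e _ _) = ⊥-elim (next≢ a (trans (sym slot⁺-res) e))
        by-case (lowered _ _ m) = m
        by-case (fixed _ ne _) = ⊥-elim (ne slot⁺-res)
      ... | no k≢a with k ℕ.≟ next a
      ...   | yes refl = by-case (genCase a (W (slot a)))
        where
        by-case : GenCase a (W (slot a)) → modN (gen a (W (slot a))) ≡ next a
        by-case (raised _ _ m) = m
        by-case (lowered e _ _) = ⊥-elim (next≢ a (trans (sym e) slot-res))
        by-case (fixed ne _ _) = ⊥-elim (ne slot-res)
      ...   | no k≢next = by-case (genCase a (W (slotOf k)))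
        where
        by-case : GenCase a (W (slotOf k)) → modN (gen a (W (slotOf k))) ≡ k
        by-case (raised e _ _) = ⊥-elim (k≢a (trans (sym (slotOf-res k k<N)) e))
        by-case (lowered e _ _) = ⊥-elim (k≢next (trans (sym (slotOf-res k k<N)) e))
        by-case (fixed _ _ g) = trans (cong modN g) (slotOf-res k k<N)

      act-res-injective : ∀ r x → modN (act a W r) ≡ modN (act a W x) → r ≡ x
      act-res-injective r x h = by-case (genCase a (W r)) (genCase a (W x))
        where
        by-case : GenCase a (W r) → GenCase a (W x) → r ≡ x
        by-case (raised e₁ _ _) (raised e₂ _ _) = res-injective r x (trans e₁ (sym e₂))
        by-case (raised _ _ m₁) (lowered _ _ m₂) = ⊥-elim (next≢ a (trans (sym m₁) (trans h m₂)))
        by-case (raised _ _ m₁) (fixed _ n₂ g₂) = ⊥-elim (n₂ (trans (sym (cong modN g₂)) (trans (sym h) m₁)))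
        by-case (lowered _ _ m₁) (raised _ _ m₂) = ⊥-elim (next≢ a (trans (sym m₂) (trans (sym h) m₁)))
        by-case (lowered e₁ _ _) (lowered e₂ _ _) = res-injective r x (trans e₁ (sym e₂))
        by-case (lowered _ _ m₁) (fixed n₁ _ g₂) = ⊥-elim (n₁ (trans (sym (cong modN g₂)) (trans (sym h) m₁)))
        by-case (fixed _ n₂ g₁) (raised _ _ m₂) = ⊥-elim (n₂ (trans (sym (cong modN g₁)) (trans h m₂)))
        by-case (fixed n₁ _ g₁) (lowered _ _ m₂) = ⊥-elim (n₁ (trans (sym (cong modN g₁)) (trans h m₂)))
        by-case (fixed _ _ g₁) (fixed _ _ g₂) = res-injective r x (trans (sym (cong modN g₁)) (trans h (cong modN g₂)))

      ∑-act : ∑ (act a W) ≡ ∑ W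
      ∑-act = +-cancelʳ _ _ (W (slot a) + W (slot⁺ a)) (begin
        ∑ (act a W) + (W (slot a) + W (slot⁺ a))
          ≡⟨ sym (ℤP.+-assoc (∑ (act a W)) _ _) ⟩
        ∑ (act a W) + W (slot a) + W (slot⁺ a)
          ≡⟨ ∑-update₂ (slot a) (slot⁺ a) slot≢slot⁺ act-other ⟩
        ∑ W + act a W (slot a) + act a W (slot⁺ a)
          ≡⟨ cong₂ (λ x y → ∑ W + x + y) act-slot act-slot⁺ ⟩
        ∑ W + (W (slot a) + 1ℤ) + (W (slot⁺ a) - 1ℤ)
          ≡⟨ shape (∑ W) (W (slot a)) (W (slot⁺ a)) ⟩
        ∑ W + (W (slot a) + W (slot⁺ a))  ∎)
        where
        open ≡-Reasoning
        shape : ∀ s x y → s + (x + 1ℤ) + (y - 1ℤ) ≡ s + (x + y)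
        shape = solve-∀

      act-affine : IsAffineWindow (act a W)
      act-affine = record
        { slotOf = slotOf′ ; slotOf-res = slotOf′-res ; res-injective = act-res-injective ; sum≡ = trans ∑-act sum≡ }

    ifLess : Fin N → Fin N → ℤ → ℤ
    ifLess x y v = if does (toℕ x ℕ.<? toℕ y) then v else 0ℤ

    ifLess-yes : ∀ x y v → toℕ x ℕ.< toℕ y → ifLess x y v ≡ v
    ifLess-yes x y v h rewrite dec-true (toℕ x ℕ.<? toℕ y) h = refl

    ifLess-no : ∀ x y v → ¬ (toℕ x ℕ.< toℕ y) → ifLess x y v ≡ 0ℤ
    ifLess-no x y v h rewrite dec-false (toℕ x ℕ.<? toℕ y) h = refl

    -- Shi's formula for the Coxeter length.
    inversionsAt : Window → Fin N → Fin N → ℤ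
    inversionsAt W x y = ifLess x y (+ ∣ divN (W y - W x) ∣)

    row : Window → Fin N → ℤ
    row W x = ∑ (inversionsAt W x)

    inversions : Window → ℤ
    inversions W = ∑ (row W)

    inversions-nonneg : ∀ W → 0ℤ ≤ inversions W
    inversions-nonneg W = ∑-nonneg λ x → ∑-nonneg λ y → nonneg x y
      where
      nonneg : ∀ x y → 0ℤ ≤ inversionsAt W x y
      nonneg x y with toℕ x ℕ.<? toℕ y
      ... | yes x<y = subst (0ℤ ≤_) (sym (ifLess-yes x y _ x<y)) (ℤ.+≤+ ℕ.z≤n)
      ... | no x≮y = ℤP.≤-reflexive (sym (ifLess-no x y _ x≮y))

    inversionsAt-diag : ∀ W x → inversionsAt W x x ≡ 0ℤ
    inversionsAt-diag W x = ifLess-no x x _ (ℕP.<-irrefl refl)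

    module InversionsUnderAct {W : Window} (isAffine : IsAffineWindow W) (a : Fin N) where
      open OnAffineWindow isAffine
      open ActOnAffineWindow isAffine a

      private
        A : Window
        A = act a W
        e e′ : Fin N
        e = slot a
        e′ = slot⁺ a

      quotient-from-slot : ∀ y → y ≢ e → y ≢ e′ → divN (A y - A e) ≡ divN (W y - W e)
      quotient-from-slot y y≢e y≢e′ = begin
        divN (A y - A e)              ≡⟨ cong₂ (λ u v → divN (u - v)) (act-other y y≢e y≢e′) act-slot ⟩
        divN (W y - (W e + 1ℤ))       ≡⟨ cong divN (shape (W y) (W e)) ⟩
        divN (W y - W e - 1ℤ)         ≡⟨ divN-pred (W y - W e) (y≢e ∘ res-injective y e ∘ modN-diff≡0⇒≡ (W y) (W e)) ⟩
        divN (W y - W e)              ∎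
        where
        open ≡-Reasoning
        shape : ∀ a b → a - (b + 1ℤ) ≡ a - b - 1ℤ
        shape = solve-∀

      quotient-from-slot⁺ : ∀ y → y ≢ e → y ≢ e′ → divN (A y - A e′) ≡ divN (W y - W e′)
      quotient-from-slot⁺ y y≢e y≢e′ = begin
        divN (A y - A e′)             ≡⟨ cong₂ (λ u v → divN (u - v)) (act-other y y≢e y≢e′) act-slot⁺ ⟩
        divN (W y - (W e′ - 1ℤ))      ≡⟨ cong divN (shape (W y) (W e′)) ⟩
        divN (W y - W e′ + 1ℤ)        ≡⟨ divN-suc (W y - W e′) res≢0 ⟩
        divN (W y - W e′)             ∎
        where
        open ≡-Reasoning
        shape : ∀ a b → a - (b - 1ℤ) ≡ a - b + 1ℤ
        shape = solve-∀
        res≢0 : modN (W y - W e′ + 1ℤ) ≢ 0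
        res≢0 h = y≢e (res-injective y e (trans
          (modN-diff≡0⇒≡ (W y) (W e′ - 1ℤ) (trans (cong modN (shape (W y) (W e′))) h))
          (trans (modN-down a (W e′) slot⁺-res) (sym slot-res))))

      quotient-to-slot : ∀ x → x ≢ e → x ≢ e′ → divN (A e - A x) ≡ divN (W e - W x)
      quotient-to-slot x x≢e x≢e′ = begin
        divN (A e - A x)              ≡⟨ cong₂ (λ u v → divN (u - v)) act-slot (act-other x x≢e x≢e′) ⟩
        divN (W e + 1ℤ - W x)         ≡⟨ cong divN (shape (W x) (W e)) ⟩
        divN (W e - W x + 1ℤ)         ≡⟨ divN-suc (W e - W x) res≢0 ⟩
        divN (W e - W x)              ∎
        where
        open ≡-Reasoning
        shape : ∀ a b → b + 1ℤ - a ≡ b - a + 1ℤ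
        shape = solve-∀
        res≢0 : modN (W e - W x + 1ℤ) ≢ 0
        res≢0 h = x≢e′ (res-injective x e′ (trans
          (sym (modN-diff≡0⇒≡ (W e + 1ℤ) (W x) (trans (cong modN (shape (W x) (W e))) h)))
          (trans (modN-up a (W e) slot-res) (sym slot⁺-res))))

      quotient-to-slot⁺ : ∀ x → x ≢ e → x ≢ e′ → divN (A e′ - A x) ≡ divN (W e′ - W x)
      quotient-to-slot⁺ x x≢e x≢e′ = begin
        divN (A e′ - A x)             ≡⟨ cong₂ (λ u v → divN (u - v)) act-slot⁺ (act-other x x≢e x≢e′) ⟩
        divN (W e′ - 1ℤ - W x)        ≡⟨ cong divN (shape (W e′) (W x)) ⟩
        divN (W e′ - W x - 1ℤ)        ≡⟨ divN-pred (W e′ - W x) (x≢e′ ∘ sym ∘ res-injective e′ x ∘ modN-diff≡0⇒≡ (W e′) (W x)) ⟩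
        divN (W e′ - W x)             ∎
        where
        open ≡-Reasoning
        shape : ∀ a b → a - 1ℤ - b ≡ a - b - 1ℤ
        shape = solve-∀

      inversionsAt-act : ∀ x y → ¬ (x ≡ e × y ≡ e′) → ¬ (x ≡ e′ × y ≡ e) → inversionsAt A x y ≡ inversionsAt W x y
      inversionsAt-act x y not-ee′ not-e′e with x FP.≟ y
      ... | yes refl = trans (inversionsAt-diag A x) (sym (inversionsAt-diag W x))
      ... | no x≢y = cong (λ u → ifLess x y (+ ∣ u ∣)) same-quotient
        where
        same-quotient : divN (A y - A x) ≡ divN (W y - W x)
        same-quotient with x FP.≟ e
        ... | yes refl = quotient-from-slot y (x≢y ∘ sym) (λ h → not-ee′ (refl , h))
        ... | no x≢e with x FP.≟ e′
        ...   | yes refl = quotient-from-slot⁺ y (λ h → not-e′e (refl , h)) (x≢y ∘ sym)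
        ...   | no x≢e′ with y FP.≟ e
        ...     | yes refl = quotient-to-slot x x≢e x≢e′
        ...     | no y≢e with y FP.≟ e′
        ...       | yes refl = quotient-to-slot⁺ x x≢e x≢e′
        ...       | no y≢e′ = cong₂ (λ u v → divN (u - v)) (act-other y y≢e y≢e′) (act-other x x≢e x≢e′)

      inversions-act-balance : inversions A + inversionsAt W e e′ + inversionsAt W e′ e
                             ≡ inversions W + inversionsAt A e e′ + inversionsAt A e′ e
      inversions-act-balance = +-cancelʳ _ _ (row W e + row W e′) (begin
        inversions A + wee′ + we′e + (row W e + row W e′)   ≡⟨ shape₁ (inversions A) wee′ we′e (row W e) (row W e′) ⟩
        inversions A + row W e + row W e′ + wee′ + we′e     ≡⟨ cong (λ u → u + wee′ + we′e) rows ⟩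
        inversions W + row A e + row A e′ + wee′ + we′e     ≡⟨ shape₂ (inversions W) (row A e) (row A e′) wee′ we′e ⟩
        inversions W + (row A e + wee′) + (row A e′ + we′e) ≡⟨ cong₂ (λ u v → inversions W + u + v) row-e row-e′ ⟩
        inversions W + (row W e + aee′) + (row W e′ + ae′e) ≡⟨ shape₃ (inversions W) (row W e) aee′ (row W e′) ae′e ⟩
        inversions W + aee′ + ae′e + (row W e + row W e′)   ∎)
        where
        open ≡-Reasoning
        wee′ we′e aee′ ae′e : ℤ
        wee′ = inversionsAt W e e′
        we′e = inversionsAt W e′ e
        aee′ = inversionsAt A e e′
        ae′e = inversionsAt A e′ e
        rows : inversions A + row W e + row W e′ ≡ inversions W + row A e + row A e′
        rows = ∑-update₂ e e′ slot≢slot⁺ λ x x≢e x≢e′ →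
          ∑-cong λ y → inversionsAt-act x y (x≢e ∘ proj₁) (x≢e′ ∘ proj₁)
        row-e : row A e + wee′ ≡ row W e + aee′
        row-e = ∑-update {f = inversionsAt A e} {g = inversionsAt W e} e′ λ y y≢e′ →
          inversionsAt-act e y (y≢e′ ∘ proj₂) (slot≢slot⁺ ∘ proj₁)
        row-e′ : row A e′ + we′e ≡ row W e′ + ae′e
        row-e′ = ∑-update {f = inversionsAt A e′} {g = inversionsAt W e′} e λ y y≢e →
          inversionsAt-act e′ y (slot≢slot⁺ ∘ sym ∘ proj₁) (y≢e ∘ proj₂)
        shape₁ : ∀ a x y r s → a + x + y + (r + s) ≡ a + r + s + x + y
        shape₁ = solve-∀
        shape₂ : ∀ b r s x y → b + r + s + x + y ≡ b + (r + x) + (s + y)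
        shape₂ = solve-∀
        shape₃ : ∀ b r x s y → b + (r + x) + (s + y) ≡ b + x + y + (r + s)
        shape₃ = solve-∀

      K : ℤ
      K = divN (W e′ - (W e + 1ℤ))

      gap≡ : W e′ - W e ≡ 1ℤ + K * Nℤ
      gap≡ = begin
        W e′ - W e                                  ≡⟨ shape (W e′) (W e) ⟩
        W e′ - (W e + 1ℤ) + 1ℤ                      ≡⟨ cong (_+ 1ℤ) (modN+divN (W e′ - (W e + 1ℤ))) ⟩
        + modN (W e′ - (W e + 1ℤ)) + K * Nℤ + 1ℤ    ≡⟨ cong (λ k → + k + K * Nℤ + 1ℤ) divisible ⟩
        0ℤ + K * Nℤ + 1ℤ                            ≡⟨ shape′ (K * Nℤ) ⟩
        1ℤ + K * Nℤ                                 ∎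
        where
        open ≡-Reasoning
        divisible : modN (W e′ - (W e + 1ℤ)) ≡ 0
        divisible = modN-diff≡0 (W e′) (W e + 1ℤ) (trans slot⁺-res (sym (modN-up a (W e) slot-res)))
        shape : ∀ x y → x - y ≡ x - (y + 1ℤ) + 1ℤ
        shape = solve-∀
        shape′ : ∀ x → 0ℤ + x + 1ℤ ≡ 1ℤ + x
        shape′ = solve-∀

      quotient-gap : divN (W e′ - W e) ≡ K
      quotient-gap = divN-char _ 1 K (ℕ.s≤s n≥1) gap≡

      quotient-gap-act : divN (A e′ - A e) ≡ K - 1ℤ
      quotient-gap-act = divN-char _ n (K - 1ℤ) (ℕP.n<1+n n) (begin
        A e′ - A e                   ≡⟨ cong₂ _-_ act-slot⁺ act-slot ⟩
        W e′ - 1ℤ - (W e + 1ℤ)       ≡⟨ shape (W e′) (W e) ⟩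
        W e′ - W e - + 2             ≡⟨ cong (_- + 2) gap≡ ⟩
        1ℤ + K * Nℤ - + 2            ≡⟨ shape′ K (+ n) ⟩
        + n + (K - 1ℤ) * Nℤ          ∎)
        where
        open ≡-Reasoning
        shape : ∀ x y → x - 1ℤ - (y + 1ℤ) ≡ x - y - + 2
        shape = solve-∀
        shape′ : ∀ K m → 1ℤ + K * (1ℤ + m) - + 2 ≡ m + (K - 1ℤ) * (1ℤ + m)
        shape′ = solve-∀

      quotient-gap⁻ : divN (W e - W e′) ≡ - K - 1ℤ
      quotient-gap⁻ = divN-char _ n (- K - 1ℤ) (ℕP.n<1+n n) (begin
        W e - W e′                   ≡⟨ shape (W e) (W e′) ⟩
        - (W e′ - W e)               ≡⟨ cong -_ gap≡ ⟩
        - (1ℤ + K * Nℤ)              ≡⟨ shape′ K (+ n) ⟩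
        + n + (- K - 1ℤ) * Nℤ        ∎)
        where
        open ≡-Reasoning
        shape : ∀ x y → x - y ≡ - (y - x)
        shape = solve-∀
        shape′ : ∀ K m → - (1ℤ + K * (1ℤ + m)) ≡ m + (- K - 1ℤ) * (1ℤ + m)
        shape′ = solve-∀

      quotient-gap⁻-act : divN (A e - A e′) ≡ - K
      quotient-gap⁻-act = divN-char _ 1 (- K) (ℕ.s≤s n≥1) (begin
        A e - A e′                   ≡⟨ cong₂ _-_ act-slot act-slot⁺ ⟩
        W e + 1ℤ - (W e′ - 1ℤ)       ≡⟨ shape (W e) (W e′) ⟩
        + 2 - (W e′ - W e)           ≡⟨ cong (λ u → + 2 - u) gap≡ ⟩
        + 2 - (1ℤ + K * Nℤ)          ≡⟨ shape′ K Nℤ ⟩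
        1ℤ + - K * Nℤ                ∎)
        where
        open ≡-Reasoning
        shape : ∀ x y → x + 1ℤ - (y - 1ℤ) ≡ + 2 - (y - x)
        shape = solve-∀
        shape′ : ∀ K m → + 2 - (1ℤ + K * m) ≡ 1ℤ + - K * m
        shape′ = solve-∀

      ActOutcome : Set
      ActOutcome = (inversions A ≡ inversions W + 1ℤ × LeftAscent a) ⊎ (inversions A + 1ℤ ≡ inversions W × LeftDescent a)

      inversions-act-slot< : toℕ e ℕ.< toℕ e′ → ActOutcome
      inversions-act-slot< e<e′ = by-kind (ascent-or-descent a)
        where
        e′≮e : ¬ (toℕ e′ ℕ.< toℕ e)
        e′≮e = ℕP.<⇒≯ e<e′
        balance : inversions A + + ∣ K ∣ ≡ inversions W + + ∣ K - 1ℤ ∣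
        balance = begin
          inversions A + + ∣ K ∣                 ≡⟨ sym (ℤP.+-identityʳ _) ⟩
          inversions A + + ∣ K ∣ + 0ℤ            ≡⟨ cong₂ (λ u v → inversions A + u + v)
                                                      (sym (trans (ifLess-yes e e′ _ e<e′) (cong (λ q → + ∣ q ∣) quotient-gap)))
                                                      (sym (ifLess-no e′ e _ e′≮e)) ⟩
          inversions A + inversionsAt W e e′ + inversionsAt W e′ e ≡⟨ inversions-act-balance ⟩
          inversions W + inversionsAt A e e′ + inversionsAt A e′ e ≡⟨ cong₂ (λ u v → inversions W + u + v)
                                                      (trans (ifLess-yes e e′ _ e<e′) (cong (λ q → + ∣ q ∣) quotient-gap-act))
                                                      (ifLess-no e′ e _ e′≮e) ⟩
          inversions W + + ∣ K - 1ℤ ∣ + 0ℤ       ≡⟨ ℤP.+-identityʳ _ ⟩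
          inversions W + + ∣ K - 1ℤ ∣            ∎
          where open ≡-Reasoning
        by-kind : LeftAscent a ⊎ LeftDescent a → ActOutcome
        by-kind (inj₁ asc) = inj₁ (cancel-+1ʳ (inversions A) (inversions W) (+ ∣ K ∣) (trans balance (cong (λ u → inversions W + u)
          (∣k-1∣≡∣k∣+1 K (quotient≤0 K (toℕ e) (toℕ e′) (FP.toℕ<n e′) (subst (_≤ + toℕ e′ - + toℕ e) gap≡ asc))))) , asc)
        by-kind (inj₂ desc) = inj₂ (cancel-+1ˡ (inversions A) (inversions W) (+ ∣ K - 1ℤ ∣) (trans (cong (λ u → inversions A + u)
          (∣k-1∣+1≡∣k∣ K (quotient≥1 K (toℕ e) (toℕ e′) e<e′ (subst (+ toℕ e′ - + toℕ e <_) gap≡ desc)))) balance) , desc)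

      inversions-act-slot> : toℕ e′ ℕ.< toℕ e → ActOutcome
      inversions-act-slot> e′<e = by-kind (ascent-or-descent a)
        where
        e≮e′ : ¬ (toℕ e ℕ.< toℕ e′)
        e≮e′ = ℕP.<⇒≯ e′<e
        balance : inversions A + + ∣ - K - 1ℤ ∣ ≡ inversions W + + ∣ - K ∣
        balance = begin
          inversions A + + ∣ - K - 1ℤ ∣          ≡⟨ cong (λ u → inversions A + u) (sym (ℤP.+-identityˡ _)) ⟩
          inversions A + (0ℤ + + ∣ - K - 1ℤ ∣)   ≡⟨ sym (ℤP.+-assoc (inversions A) _ _) ⟩
          inversions A + 0ℤ + + ∣ - K - 1ℤ ∣     ≡⟨ cong₂ (λ u v → inversions A + u + v)
                                                      (sym (ifLess-no e e′ _ e≮e′))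
                                                      (sym (trans (ifLess-yes e′ e _ e′<e) (cong (λ q → + ∣ q ∣) quotient-gap⁻))) ⟩
          inversions A + inversionsAt W e e′ + inversionsAt W e′ e ≡⟨ inversions-act-balance ⟩
          inversions W + inversionsAt A e e′ + inversionsAt A e′ e ≡⟨ cong₂ (λ u v → inversions W + u + v)
                                                      (ifLess-no e e′ _ e≮e′)
                                                      (trans (ifLess-yes e′ e _ e′<e) (cong (λ q → + ∣ q ∣) quotient-gap⁻-act)) ⟩
          inversions W + 0ℤ + + ∣ - K ∣          ≡⟨ ℤP.+-assoc (inversions W) _ _ ⟩
          inversions W + (0ℤ + + ∣ - K ∣)        ≡⟨ cong (λ u → inversions W + u) (ℤP.+-identityˡ _) ⟩
          inversions W + + ∣ - K ∣               ∎
          where open ≡-Reasoning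
        by-kind : LeftAscent a ⊎ LeftDescent a → ActOutcome
        by-kind (inj₁ asc) = inj₁ (cancel-+1ʳ (inversions A) (inversions W) (+ ∣ - K - 1ℤ ∣) (trans balance (cong (λ u → inversions W + u)
          (sym (∣k-1∣+1≡∣k∣ (- K) (ℤP.neg-mono-≤ (quotient≤-1 K (toℕ e) (toℕ e′) e′<e (subst (_≤ + toℕ e′ - + toℕ e) gap≡ asc))))))) , asc)
        by-kind (inj₂ desc) = inj₂ (cancel-+1ˡ (inversions A) (inversions W) (+ ∣ - K ∣) (trans (cong (λ u → inversions A + u)
          (sym (∣k-1∣≡∣k∣+1 (- K) (ℤP.neg-mono-≤ (quotient≥0 K (toℕ e) (toℕ e′) (FP.toℕ<n e) (subst (+ toℕ e′ - + toℕ e <_) gap≡ desc)))))) balance) , desc)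

      inversions-act : ActOutcome
      inversions-act with ℕP.<-cmp (toℕ e) (toℕ e′)
      ... | tri< e<e′ _ _ = inversions-act-slot< e<e′
      ... | tri≈ _ e≡e′ _ = ⊥-elim (slot≢slot⁺ (FP.toℕ-injective e≡e′))
      ... | tri> _ _ e′<e = inversions-act-slot> e′<e

    Consecutive : Window → Set
    Consecutive W = ∀ r → W r ≡ W F.zero + + toℕ r

    +-suc′ : ∀ j m → j + + suc m ≡ j + + m + 1ℤ
    +-suc′ j m = trans (cong (λ u → j + u) (ℤP.+-comm 1ℤ (+ m))) (sym (ℤP.+-assoc j (+ m) 1ℤ))

    module AllAscents {W : Window} (isAffine : IsAffineWindow W) (allAscents : ∀ a → OnAffineWindow.LeftAscent isAffine a) where
      open OnAffineWindow isAffine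

      preimage-+1≥ : ∀ j → preimage j + 1ℤ ≤ preimage (j + 1ℤ)
      preimage-+1≥ j = <⇒+1≤ (subst (λ u → preimage u < preimage (j + 1ℤ)) (z+1-1≡z j)
                         (ascent⇒preimage< a (j + 1ℤ) (allAscents a) (modN-up a j (sym (FP.toℕ-fromℕ< (modN<N j))))))
        where
        a : Fin N
        a = F.fromℕ< (modN<N j)

      preimage-+N : ∀ j → preimage (j + Nℤ) ≡ preimage j + Nℤ
      preimage-+N j =
        trans (cong (λ x → + toℕ x + (j + Nℤ - W x)) same-slot) (shape (+ toℕ (slotOfValue j)) j (W (slotOfValue j)) Nℤ)
        where
        same-slot : slotOfValue (j + Nℤ) ≡ slotOfValue j
        same-slot = cong slotOf (trans (cong modN (cong (λ u → j + u) (sym (ℤP.*-identityˡ Nℤ)))) (modN-shift j 1ℤ))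
        shape : ∀ e j w m → e + (j + m - w) ≡ e + (j - w) + m
        shape = solve-∀

      preimage-+≥ : ∀ j m → preimage j + + m ≤ preimage (j + + m)
      preimage-+≥ j zero = ℤP.≤-reflexive (trans (ℤP.+-identityʳ _) (cong preimage (sym (ℤP.+-identityʳ j))))
      preimage-+≥ j (suc m) =
        subst₂ _≤_ (sym (+-suc′ (preimage j) m)) (cong preimage (sym (+-suc′ j m)))
          (ℤP.≤-trans (ℤP.+-monoˡ-≤ 1ℤ (preimage-+≥ j m)) (preimage-+1≥ (j + + m)))

      -- Going up n more steps gains at least n, but the gain over N steps is exactly N.
      preimage-+1 : ∀ j → preimage (j + 1ℤ) ≡ preimage j + 1ℤ
      preimage-+1 j = ℤP.≤-antisym at-most (preimage-+1≥ j)
        where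
        shape : ∀ j m → j + 1ℤ + m ≡ j + (1ℤ + m)
        shape = solve-∀
        via-N : preimage (j + 1ℤ) + + n ≤ preimage j + 1ℤ + + n
        via-N = subst (preimage (j + 1ℤ) + + n ≤_)
          (trans (cong preimage (shape j (+ n))) (trans (preimage-+N j) (sym (ℤP.+-assoc (preimage j) 1ℤ (+ n)))))
          (preimage-+≥ (j + 1ℤ) n)
        at-most : preimage (j + 1ℤ) ≤ preimage j + 1ℤ
        at-most = +-cancelʳ-≤ (preimage (j + 1ℤ)) (preimage j + 1ℤ) (+ n) via-N

      preimage-+ : ∀ j m → preimage (j + + m) ≡ preimage j + + m
      preimage-+ j zero = trans (cong preimage (ℤP.+-identityʳ j)) (sym (ℤP.+-identityʳ _))
      preimage-+ j (suc m) =
        trans (cong preimage (+-suc′ j m))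
          (trans (preimage-+1 (j + + m)) (trans (cong (_+ 1ℤ) (preimage-+ j m)) (sym (+-suc′ (preimage j) m))))

      preimage-value : ∀ r → preimage (W r) ≡ + toℕ r
      preimage-value r =
        trans (cong (λ x → + toℕ x + (W r - W x)) (sym (slotOfValue-unique r (W r) refl)))
              (trans (cong (λ u → + toℕ r + u) (ℤP.+-inverseʳ (W r))) (ℤP.+-identityʳ _))

      consecutive : Consecutive W
      consecutive r with ≤-or-> (W F.zero) (W r)
      ... | inj₁ le with ≤-offset le
      ...   | m , Wr≡ = trans Wr≡ (cong (λ u → W F.zero + u) m≡r)
        where
        m≡r : + m ≡ + toℕ r
        m≡r = begin
          + m                             ≡⟨ sym (ℤP.+-identityˡ (+ m)) ⟩
          0ℤ + + m                        ≡⟨ cong (_+ + m) (sym (preimage-value F.zero)) ⟩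
          preimage (W F.zero) + + m       ≡⟨ sym (preimage-+ (W F.zero) m) ⟩
          preimage (W F.zero + + m)       ≡⟨ cong preimage (sym Wr≡) ⟩
          preimage (W r)                  ≡⟨ preimage-value r ⟩
          + toℕ r                         ∎
          where open ≡-Reasoning
      consecutive r | inj₂ lt with ≤-offset (<⇒+1≤ lt)
      ...   | m , W0≡ = ⊥-elim (ℤP.<-irrefl 0≡ (0≤⇒0<+1 {+ toℕ r + + m} (ℤ.+≤+ ℕ.z≤n)))
        where
        0≡ : 0ℤ ≡ + toℕ r + + m + 1ℤ
        0≡ = begin
          0ℤ                              ≡⟨ sym (preimage-value F.zero) ⟩
          preimage (W F.zero)             ≡⟨ cong preimage W0≡ ⟩
          preimage (W r + 1ℤ + + m)       ≡⟨ preimage-+ (W r + 1ℤ) m ⟩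
          preimage (W r + 1ℤ) + + m       ≡⟨ cong (_+ + m) (trans (preimage-+1 (W r)) (cong (_+ 1ℤ) (preimage-value r))) ⟩
          + toℕ r + 1ℤ + + m              ≡⟨ shape (+ toℕ r) (+ m) ⟩
          + toℕ r + + m + 1ℤ              ∎
          where
          open ≡-Reasoning
          shape : ∀ a b → a + 1ℤ + b ≡ a + b + 1ℤ
          shape = solve-∀

    consecutive⇒inversions≡0 : ∀ W → Consecutive W → inversions W ≡ 0ℤ
    consecutive⇒inversions≡0 W cons = ∑-zero λ x → ∑-zero λ y → vanishes x y
      where
      vanishes : ∀ x y → inversionsAt W x y ≡ 0ℤ
      vanishes x y with toℕ x ℕ.<? toℕ y
      ... | no x≮y = ifLess-no x y _ x≮y
      ... | yes x<y = trans (ifLess-yes x y _ x<y) (cong (λ u → + ∣ u ∣) (trans (cong divN gap) small))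
        where
        shape : ∀ a b c → a + b - (a + c) ≡ b - c
        shape = solve-∀
        gap : W y - W x ≡ + (toℕ y ℕ.∸ toℕ x)
        gap = trans (cong₂ _-_ (cons y) (cons x)) (trans (shape (W F.zero) (+ toℕ y) (+ toℕ x))
               (trans (ℤP.m-n≡m⊖n (toℕ y) (toℕ x)) (ℤP.⊖-≥ (ℕP.<⇒≤ x<y))))
        small : divN (+ (toℕ y ℕ.∸ toℕ x)) ≡ 0ℤ
        small = cong +_ (ℕD.m<n⇒m/n≡0 (ℕP.≤-<-trans (ℕP.m∸n≤m (toℕ y) (toℕ x)) (FP.toℕ<n y)))

    consecutive⇒id : ∀ {W} → IsAffineWindow W → Consecutive W → ∀ r → W r ≡ idWindow r
    consecutive⇒id {W} isAffine cons r =
      trans (cons r) (cong (_+ + toℕ r) W0≡1)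
      where
      S : ℤ
      S = ∑ {N} (λ r → + toℕ r)
      ∑W : ∑ W ≡ Nℤ * W F.zero + S
      ∑W = trans (∑-cong {N} cons) (trans (∑-+ {N} (λ _ → W F.zero) (λ r → + toℕ r)) (cong (_+ S) (∑-const {N} (W F.zero))))
      ∑id : ∑ idWindow ≡ Nℤ * 1ℤ + S
      ∑id = trans (∑-+ {N} (λ _ → 1ℤ) (λ r → + toℕ r)) (cong (_+ S) (∑-const {N} 1ℤ))
      W0≡1 : W F.zero ≡ 1ℤ
      W0≡1 = ℤP.*-cancelˡ-≡ Nℤ (W F.zero) 1ℤ
               (+-cancelʳ _ _ S (trans (sym ∑W) (trans (IsAffineWindow.sum≡ isAffine) ∑id)))

    all-or-exists : ∀ {m} {P Q : Fin m → Set} → (∀ a → P a ⊎ Q a) → (∀ a → P a) ⊎ Σ (Fin m) Q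
    all-or-exists {zero} f = inj₁ (λ ())
    all-or-exists {suc m} {P} {Q} f with f F.zero
    ... | inj₂ q = inj₂ (F.zero , q)
    ... | inj₁ p with all-or-exists {m} {P ∘ F.suc} {Q ∘ F.suc} (f ∘ F.suc)
    ...   | inj₁ ps = inj₁ λ { F.zero → p ; (F.suc a) → ps a }
    ...   | inj₂ (a , q) = inj₂ (F.suc a , q)

    inversions≡0⇒id : ∀ {W} → IsAffineWindow W → inversions W ≡ 0ℤ → ∀ r → W r ≡ idWindow r
    inversions≡0⇒id {W} isAffine inv≡0 = consecutive⇒id isAffine (AllAscents.consecutive isAffine ascent)
      where
      ascent : ∀ a → OnAffineWindow.LeftAscent isAffine a
      ascent a with InversionsUnderAct.inversions-act isAffine a
      ... | inj₁ (_ , asc) = asc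
      ... | inj₂ (inv+1≡ , _) =
        ⊥-elim (ℤP.<-irrefl (sym (trans inv+1≡ inv≡0)) (0≤⇒0<+1 (inversions-nonneg (act a W))))

    descent-exists : ∀ {W} (isAffine : IsAffineWindow W) → inversions W ≢ 0ℤ →
                     Σ (Fin N) λ a → inversions (act a W) + 1ℤ ≡ inversions W × OnAffineWindow.LeftDescent isAffine a
    descent-exists {W} isAffine inv≢0 with all-or-exists (InversionsUnderAct.inversions-act isAffine)
    ... | inj₂ found = found
    ... | inj₁ ascents =
      ⊥-elim (inv≢0 (consecutive⇒inversions≡0 W (AllAscents.consecutive isAffine (proj₂ ∘ ascents))))

    inversions-act≤ : ∀ {W} → IsAffineWindow W → ∀ a → inversions (act a W) ≤ inversions W + 1ℤ
    inversions-act≤ {W} isAffine a with InversionsUnderAct.inversions-act isAffine a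
    ... | inj₁ (inv≡ , _) = ℤP.≤-reflexive inv≡
    ... | inj₂ (inv+1≡ , _) =
      subst (inversions (act a W) ≤_) (trans (shape (inversions (act a W))) (cong (_+ 1ℤ) inv+1≡))
            (ℤP.i≤i+j (inversions (act a W)) (+ 2))
      where
      shape : ∀ x → x + + 2 ≡ x + 1ℤ + 1ℤ
      shape = solve-∀

    affine-cong : ∀ {W W′} → (∀ r → W r ≡ W′ r) → IsAffineWindow W → IsAffineWindow W′
    affine-cong {W} {W′} W≗W′ isAffine = record
      { slotOf = slotOf
      ; slotOf-res = λ k k<N → trans (cong modN (sym (W≗W′ _))) (slotOf-res k k<N)
      ; res-injective = λ r x h → res-injective r x (trans (cong modN (W≗W′ r)) (trans h (cong modN (sym (W≗W′ x)))))
      ; sum≡ = trans (∑-cong (sym ∘ W≗W′)) sum≡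
      }
      where open IsAffineWindow isAffine

    windowOf : Permutation′ N → Weight n → Window
    windowOf w μ r = μ r * Nℤ + + suc (toℕ (w ⟨$⟩ʳ r))

    windowOf-res : ∀ w μ r → modN (windowOf w μ r) ≡ next (w ⟨$⟩ʳ r)
    windowOf-res w μ r = trans (cong modN (ℤP.+-comm (μ r * Nℤ) _)) (modN-shift (+ suc (toℕ (w ⟨$⟩ʳ r))) (μ r))

    windowOf-affine : ∀ w μ → InZΦ' μ → IsAffineWindow (windowOf w μ)
    windowOf-affine w μ μ∈ZΦ′ = record
      { slotOf = λ k → w ⟨$⟩ˡ previous k
      ; slotOf-res = λ k k<N →
          trans (windowOf-res w μ _) (trans (cong next (Perm.inverseʳ w)) (next-previous k k<N))
      ; res-injective = λ r x h →
          trans (sym (Perm.inverseˡ w))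
            (trans (cong (w ⟨$⟩ˡ_) (next-injective _ _ (trans (sym (windowOf-res w μ r)) (trans h (windowOf-res w μ x)))))
                   (Perm.inverseˡ w))
      ; sum≡ = trans (∑-+ (λ r → μ r * Nℤ) (λ r → + suc (toℕ (w ⟨$⟩ʳ r))))
                 (trans (cong₂ _+_ (trans (∑-*ʳ μ Nℤ) (cong (_* Nℤ) μ∈ZΦ′)) (sym (∑-permute idWindow w)))
                        (ℤP.+-identityˡ (∑ idWindow)))
      }

    idWindow-affine : IsAffineWindow idWindow
    idWindow-affine = affine-cong (λ r → ℤP.+-identityˡ _) (windowOf-affine Perm.id (λ _ → 0ℤ) (∑-zero {N} (λ _ → refl)))

    window-affine : ∀ ws → IsAffineWindow (window ws)
    window-affine [] = idWindow-affine
    window-affine (a ∷ ws) = ActOnAffineWindow.act-affine (window-affine ws) a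

    represents⇒window≗ : ∀ ws W → Represents ws (extend W) → ∀ r → window ws r ≡ W r
    represents⇒window≗ ws W h r = begin
      window ws r                           ≡⟨ sym (extend-at (window ws) r) ⟩
      extend (window ws) (+ suc (toℕ r))    ≡⟨ sym (eval≡extend-window ws (+ suc (toℕ r))) ⟩
      eval ws (+ suc (toℕ r))               ≡⟨ h (+ suc (toℕ r)) ⟩
      extend W (+ suc (toℕ r))              ≡⟨ extend-at W r ⟩
      W r                                   ∎
      where open ≡-Reasoning

    window≗⇒represents : ∀ ws W → (∀ r → window ws r ≡ W r) → Represents ws (extend W)
    window≗⇒represents ws W h t = trans (eval≡extend-window ws t) (cong (λ x → x + quo n t * Nℤ) (h (rem n t)))

    inversions-cong : ∀ {W W′} → (∀ r → W r ≡ W′ r) → inversions W ≡ inversions W′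
    inversions-cong W≗W′ = ∑-cong λ x → ∑-cong λ y → cong₂ (λ u v → ifLess x y (+ ∣ divN (u - v) ∣)) (W≗W′ y) (W≗W′ x)

    count-cong : ∀ {W W′} → (∀ r → W r ≡ W′ r) → ∀ i j → count W i j ≡ count W′ i j
    count-cong W≗W′ i j = ∑-cong λ r → cong (λ u → (divN (u - j) + 𝟙≤ r i) ⁺) (W≗W′ r)

    ≼-cong : ∀ {U U′ V V′} → (∀ r → U r ≡ U′ r) → (∀ r → V r ≡ V′ r) → U ≼ V → U′ ≼ V′
    ≼-cong U≗U′ V≗V′ U≼V i j = subst₂ _≤_ (count-cong U≗U′ i j) (count-cong V≗V′ i j) (U≼V i j)

    act-involutive : ∀ a W r → act a (act a W) r ≡ W r
    act-involutive a W r = gen-involutive a (W r)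

    inversions≤length : ∀ ws → inversions (window ws) ≤ + length ws
    inversions≤length [] = ℤP.≤-reflexive (consecutive⇒inversions≡0 idWindow (λ r → refl))
    inversions≤length (a ∷ ws) =
      ℤP.≤-trans (inversions-act≤ (window-affine ws) a)
        (subst (inversions (window ws) + 1ℤ ≤_) (cong +_ (ℕP.+-comm (length ws) 1))
               (ℤP.+-monoˡ-≤ 1ℤ (inversions≤length ws)))

    inversions-as-ℕ : ∀ W → Σ ℕ λ k → inversions W ≡ + k
    inversions-as-ℕ W = ∣ inversions W ∣ , sym (ℤP.0≤i⇒+∣i∣≡i (inversions-nonneg W))

    word-of-length : ∀ k W → IsAffineWindow W → inversions W ≡ + k →
                     Σ (Word n) λ ws → (∀ r → window ws r ≡ W r) × length ws ≡ k
    word-of-length zero W isAffine inv≡0 = [] , (λ r → sym (inversions≡0⇒id isAffine inv≡0 r)) , refl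
    word-of-length (suc k) W isAffine inv≡ with descent-exists isAffine (λ h → ℕP.0≢1+n (ℤP.+-injective (trans (sym h) inv≡)))
    ... | a , inv+1≡ , _ with word-of-length k (act a W) (ActOnAffineWindow.act-affine isAffine a)
                               (+-cancelʳ _ _ 1ℤ (trans inv+1≡ (trans inv≡ (cong +_ (ℕP.+-comm 1 k)))))
    ...   | ws , window≗ , len≡ =
      (a ∷ ws) , (λ r → trans (cong (gen a) (window≗ r)) (act-involutive a W r)) , cong suc len≡

    MinimalWord : Word n → Set
    MinimalWord ws = ∀ (vs : Word n) → Represents vs (eval ws) → length ws ℕ.≤ length vs

    minimal-tail : ∀ a ws → MinimalWord (a ∷ ws) → MinimalWord ws
    minimal-tail a ws minimal vs h = ℕP.≤-pred (minimal (a ∷ vs) (λ t → cong (gen a) (h t)))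

    minimal⇒ascent : ∀ a ws → MinimalWord (a ∷ ws) → OnAffineWindow.LeftAscent (window-affine ws) a
    minimal⇒ascent a ws minimal with InversionsUnderAct.inversions-act (window-affine ws) a
    ... | inj₁ (_ , asc) = asc
    ... | inj₂ (inv+1≡ , _) with inversions-as-ℕ (act a (window ws))
    ...   | k , inv≡k with word-of-length k (act a (window ws)) (ActOnAffineWindow.act-affine (window-affine ws) a) inv≡k
    ...     | vs , window≗ , len≡ = ⊥-elim (ℕP.<-asym (ℕP.<-≤-trans (ℕP.m<m+n k (ℕ.s≤s ℕ.z≤n)) k+1≤) (subst (suc (length ws) ℕ.≤_) len≡ longer))
      where
      longer : suc (length ws) ℕ.≤ length vs
      longer = minimal vs λ t → trans (window≗⇒represents vs (act a (window ws)) window≗ t) (sym (eval≡extend-window (a ∷ ws) t))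
      k+1≤ : k ℕ.+ 1 ℕ.≤ length ws
      k+1≤ = ℤP.drop‿+≤+ (subst (_≤ + length ws) (trans (sym inv+1≡) (cong (_+ 1ℤ) inv≡k)) (inversions≤length ws))

    hits-nonneg : ∀ W i j → 0ℤ ≤ hits W i j
    hits-nonneg W i j = ∑-nonneg nonneg
      where
      nonneg : ∀ r → 0ℤ ≤ hitAt W i j r
      nonneg r with modN (W r - j)
      ... | zero = bit-nonneg (𝟙-bit _)
      ... | suc _ = ℤP.≤-refl

    count-antitone : ∀ W i j m → count W i (j + + m) ≤ count W i j
    count-antitone W i j zero = ℤP.≤-reflexive (cong (count W i) (ℤP.+-identityʳ j))
    count-antitone W i j (suc m) =
      subst (λ u → count W i u ≤ count W i j) (sym (+-suc′ j m))
        (ℤP.≤-trans step (count-antitone W i j m))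
      where
      step : count W i (j + + m + 1ℤ) ≤ count W i (j + + m)
      step = subst₂ _≤_ (ℤP.+-identityʳ _) (sym (count-step W i (j + + m)))
                    (ℤP.+-monoʳ-≤ (count W i (j + + m + 1ℤ)) (hits-nonneg W i (j + + m)))

    divN-below-diagonal : ∀ (i r : Fin N) → toℕ r ℕ.≤ toℕ i → divN (+ suc (toℕ r) - (+ toℕ i + + 2)) ≡ -1ℤ
    divN-below-diagonal i r r≤i = divN-bounds (+ suc (toℕ r) - (+ toℕ i + + 2)) -1ℤ
      (≤-from-diff (ℤP.+-mono-≤ (ℤ.+≤+ {0} {toℕ r} ℕ.z≤n) (ℤ.+≤+ (ℕP.≤-pred (FP.toℕ<n i))))
                   (shape (+ toℕ r) (+ toℕ i) (+ n)))
      (+1≤⇒< (≤-from-diff (ℤ.+≤+ r≤i) (shape′ (+ toℕ r) (+ toℕ i) Nℤ)))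
      where
      shape : ∀ R I M → (R + M) - (0ℤ + I) ≡ ((1ℤ + R) - (I + + 2)) - (-1ℤ * (1ℤ + M))
      shape = solve-∀
      shape′ : ∀ R I M → I - R ≡ (-1ℤ * M + M) - (1ℤ + R - (I + + 2) + 1ℤ)
      shape′ = solve-∀

    divN-above-diagonal : ∀ (i r : Fin N) → toℕ i ℕ.< toℕ r → divN (+ suc (toℕ r) - (+ toℕ i + + 2)) ≡ 0ℤ
    divN-above-diagonal i r i<r = divN-bounds (+ suc (toℕ r) - (+ toℕ i + + 2)) 0ℤ
      (≤-from-diff (ℤ.+≤+ i<r) (shape (+ toℕ r) (+ toℕ i) Nℤ))
      (+1≤⇒< (≤-from-diff (ℤP.+-mono-≤ (ℤP.+-mono-≤ (ℤ.+≤+ (ℕP.≤-pred (FP.toℕ<n r))) (ℤ.+≤+ {0} {toℕ i} ℕ.z≤n))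
                                        (ℤ.+≤+ {0} {1} ℕ.z≤n))
                          (shape′ (+ toℕ r) (+ toℕ i) (+ n))))
      where
      shape : ∀ R I M → R - (1ℤ + I) ≡ (1ℤ + R - (I + + 2)) - 0ℤ * M
      shape = solve-∀
      shape′ : ∀ R I M → (M + I + 1ℤ) - (R + 0ℤ + 0ℤ) ≡ (0ℤ * (1ℤ + M) + (1ℤ + M)) - ((1ℤ + R) - (I + + 2) + 1ℤ)
      shape′ = solve-∀

    count-id-vanishes : ∀ i → count idWindow i (+ toℕ i + + 2) ≡ 0ℤ
    count-id-vanishes i = ∑-zero vanishes
      where
      vanishes : ∀ r → countAt idWindow i (+ toℕ i + + 2) r ≡ 0ℤ
      vanishes r with ℕP.≤-<-connex (toℕ r) (toℕ i)
      ... | inj₁ r≤i = cong _⁺ (cong₂ _+_ (divN-below-diagonal i r r≤i) (𝟙≤-yes r i r≤i))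
      ... | inj₂ i<r = cong _⁺ (cong₂ _+_ (divN-above-diagonal i r i<r) (𝟙≤-no r i i<r))

    count-at-own-value : ∀ U i → 1ℤ ≤ count U i (U i)
    count-at-own-value U i =
      subst (_≤ count U i (U i)) own-term (term≤∑ {f = countAt U i (U i)} i (λ r → ⁺-nonneg _))
      where
      own-term : countAt U i (U i) i ≡ 1ℤ
      own-term = cong _⁺ (cong₂ _+_ (cong divN (ℤP.+-inverseʳ (U i))) (𝟙≤-yes i i ℕP.≤-refl))

    ≼id⇒id : ∀ {U} → IsAffineWindow U → U ≼ idWindow → ∀ r → U r ≡ idWindow r
    ≼id⇒id {U} isAffine U≼id = ∑-≤-≡⇒≡ U idWindow bounded (IsAffineWindow.sum≡ isAffine)
      where
      -- A larger value U i ≥ i + 2 would be counted at level U i, where the identity counts nothing.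
      bounded : ∀ i → U i ≤ idWindow i
      bounded i with ≤-or-> (U i) (idWindow i)
      ... | inj₁ h = h
      ... | inj₂ h with ≤-offset (<⇒+1≤ h)
      ...   | m , Ui≡ = ⊥-elim (ℤP.≤⇒≯ (ℤP.≤-trans (count-at-own-value U i) (ℤP.≤-trans (U≼id i (U i)) id-count≤0)) (ℤ.+<+ (ℕ.s≤s ℕ.z≤n)))
        where
        Ui≡′ : U i ≡ + toℕ i + + 2 + + m
        Ui≡′ = trans Ui≡ (cong (_+ + m) (cong +_ (trans (ℕP.+-comm (suc (toℕ i)) 1) (ℕP.+-comm 2 (toℕ i)))))
        id-count≤0 : count idWindow i (U i) ≤ 0ℤ
        id-count≤0 = subst (λ u → count idWindow i u ≤ 0ℤ) (sym Ui≡′)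
          (subst (count idWindow i (+ toℕ i + + 2 + + m) ≤_) (count-id-vanishes i) (count-antitone idWindow i (+ toℕ i + + 2) m))

    subword⇒≼ : ∀ {us ws} → MinimalWord ws → us ⊆ ws → window us ≼ window ws
    subword⇒≼ minimal [] = ≼-refl {idWindow}
    subword⇒≼ {us} {a ∷ ws} minimal (.a ∷ʳ us⊆ws) =
      ≼-trans {window us} {window ws} {window (a ∷ ws)}
        (subword⇒≼ (minimal-tail a ws minimal) us⊆ws)
        (≼-act-ascent (window-affine ws) a (minimal⇒ascent a ws minimal))
    subword⇒≼ {a ∷ us} {.a ∷ ws} minimal (refl ∷ us⊆ws) =
      ≼-lift (window-affine us) (window-affine ws) a (minimal⇒ascent a ws minimal)
             (subword⇒≼ (minimal-tail a ws minimal) us⊆ws)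

    SubwordRealisation : ℕ → Window → Window → Set
    SubwordRealisation k V U =
      Σ (Word n) λ ws → Σ (Word n) λ us →
        (∀ r → window ws r ≡ V r) × length ws ≡ k × us ⊆ ws × (∀ r → window us r ≡ U r)

    -- Peel off a left descent a of V: by the lifting lemmas U or s_a U lies below s_a V.
    ≼⇒subword : ∀ k V → IsAffineWindow V → inversions V ≡ + k →
                ∀ U → IsAffineWindow U → U ≼ V → SubwordRealisation k V U
    ≼⇒subword zero V isAffineV inv≡0 U isAffineU U≼V =
      [] , [] , (λ r → sym (inversions≡0⇒id isAffineV inv≡0 r)) , refl , [] ,
      (λ r → sym (≼id⇒id isAffineU (≼-cong {U} {U} {V} {idWindow} (λ _ → refl) (inversions≡0⇒id isAffineV inv≡0) U≼V) r))
    ≼⇒subword (suc k) V isAffineV inv≡ U isAffineU U≼V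
      with descent-exists isAffineV (λ h → ℕP.0≢1+n (ℤP.+-injective (trans (sym h) inv≡)))
    ... | a , inv+1≡ , descV = by-kind (InversionsUnderAct.inversions-act isAffineU a)
      where
      inv-act≡ : inversions (act a V) ≡ + k
      inv-act≡ = +-cancelʳ _ _ 1ℤ (trans inv+1≡ (trans inv≡ (cong +_ (ℕP.+-comm 1 k))))
      isAffine-act : IsAffineWindow (act a V)
      isAffine-act = ActOnAffineWindow.act-affine isAffineV a
      undo : ∀ {X} ws → (∀ r → window ws r ≡ act a X r) → ∀ r → window (a ∷ ws) r ≡ X r
      undo {X} ws h r = trans (cong (gen a) (h r)) (act-involutive a X r)
      by-kind : InversionsUnderAct.ActOutcome isAffineU a → SubwordRealisation (suc k) V U
      by-kind (inj₂ (_ , descU))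
        with ≼⇒subword k (act a V) isAffine-act inv-act≡ (act a U) (ActOnAffineWindow.act-affine isAffineU a)
                        (≼-lift-descents isAffineU isAffineV a descU descV U≼V)
      ... | ws , us , window-ws , len≡ , us⊆ws , window-us =
        (a ∷ ws) , (a ∷ us) , undo ws window-ws , cong suc len≡ , (refl ∷ us⊆ws) , undo us window-us
      by-kind (inj₁ (_ , ascU))
        with ≼⇒subword k (act a V) isAffine-act inv-act≡ U isAffineU (≼-act-descent isAffineU isAffineV a ascU descV U≼V)
      ... | ws , us , window-ws , len≡ , us⊆ws , window-us =
        (a ∷ ws) , us , undo ws window-ws , cong suc len≡ , (a ∷ʳ us⊆ws) , window-us

    bruhat⇒≼ : ∀ U V → BruhatLe n (extend U) (extend V) → U ≼ V
    bruhat⇒≼ U V (ws , (represents-V , minimal) , us , us⊆ws , represents-U) =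
      ≼-cong (represents⇒window≗ us U represents-U) (represents⇒window≗ ws V represents-V)
             (subword⇒≼ minimal′ us⊆ws)
      where
      minimal′ : MinimalWord ws
      minimal′ vs h = minimal vs (λ t → trans (h t) (represents-V t))

    ≼⇒bruhat : ∀ U V → IsAffineWindow U → IsAffineWindow V → U ≼ V → BruhatLe n (extend U) (extend V)
    ≼⇒bruhat U V isAffineU isAffineV U≼V with inversions-as-ℕ V
    ... | k , inv≡ with ≼⇒subword k V isAffineV inv≡ U isAffineU U≼V
    ...   | ws , us , window-ws , len≡ , us⊆ws , window-us =
      ws , (window≗⇒represents ws V window-ws , minimal) , us , us⊆ws , window≗⇒represents us U window-us
      where
      minimal : ∀ (vs : Word n) → Represents vs (extend V) → length ws ℕ.≤ length vs
      minimal vs h = subst (ℕ._≤ length vs) (sym len≡)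
        (ℤP.drop‿+≤+ (subst (_≤ + length vs) (trans (inversions-cong (represents⇒window≗ vs V h)) inv≡)
                                              (inversions≤length vs)))

    shiftedWeight : Permutation′ N → Weight n → ℕ → ℕ → Weight n
    shiftedWeight w μ i J = (μ +ʷ ϖ' i) -ʷ actInv w (ϖ' J)

    ∑-shiftedWeight : ∀ w μ i J → InZΦ' μ → ∑ (shiftedWeight w μ i J) ≡ ∑ (ϖ' {n} i) - ∑ (ϖ' {n} J)
    ∑-shiftedWeight w μ i J μ∈ZΦ′ =
      trans (∑-minus (λ r → μ r + ϖ' i r) (λ r → ϖ' J (w ⟨$⟩ʳ r)))
        (cong₂ _-_ (trans (∑-+ μ (ϖ' i)) (trans (cong (_+ ∑ (ϖ' {n} i)) μ∈ZΦ′) (ℤP.+-identityˡ (∑ (ϖ' {n} i)))))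
                   (sym (∑-permute (ϖ' J) w)))

    windowOf-split : ∀ w μ j r →
      windowOf w μ r - j ≡ (μ r - divN (j - 1ℤ)) * Nℤ + (+ toℕ (w ⟨$⟩ʳ r) - + modN (j - 1ℤ))
    windowOf-split w μ j r = begin
      μ r * Nℤ + + suc c - j               ≡⟨ shape (μ r) (+ c) j Nℤ ⟩
      μ r * Nℤ + + c - (j - 1ℤ)            ≡⟨ cong (λ u → μ r * Nℤ + + c - u) (modN+divN (j - 1ℤ)) ⟩
      μ r * Nℤ + + c - (+ J + k * Nℤ)      ≡⟨ shape′ (μ r) (+ c) (+ J) k Nℤ ⟩
      (μ r - k) * Nℤ + (+ c - + J)         ∎
      where
      open ≡-Reasoning
      J : ℕ
      J = modN (j - 1ℤ)
      k : ℤ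
      k = divN (j - 1ℤ)
      c : ℕ
      c = toℕ (w ⟨$⟩ʳ r)
      shape : ∀ m c j N → m * N + (1ℤ + c) - j ≡ m * N + c - (j - 1ℤ)
      shape = solve-∀
      shape′ : ∀ m c J k N → m * N + c - (J + k * N) ≡ (m - k) * N + (c - J)
      shape′ = solve-∀

    divN-windowOf : ∀ w μ j r → divN (windowOf w μ r - j) ≡ μ r - divN (j - 1ℤ) - ϖ' (modN (j - 1ℤ)) (w ⟨$⟩ʳ r)
    divN-windowOf w μ j r = by-case (ℕP.≤-<-connex J c)
      where
      J : ℕ
      J = modN (j - 1ℤ)
      k : ℤ
      k = divN (j - 1ℤ)
      c : ℕ
      c = toℕ (w ⟨$⟩ʳ r)
      shape : ∀ q D m → q * m + D ≡ (q - 1ℤ) * m + (m + D)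
      shape = solve-∀
      shape₀ : ∀ a b c → (a + b) - (c + 0ℤ) ≡ (a + (b - c)) - 0ℤ
      shape₀ = solve-∀
      shape₁ : ∀ a b c → c - b ≡ a - (a + (b - c))
      shape₁ = solve-∀
      by-case : J ℕ.≤ c ⊎ c ℕ.< J → divN (windowOf w μ r - j) ≡ μ r - k - ϖ' J (w ⟨$⟩ʳ r)
      by-case (inj₁ J≤c) = begin
        divN (windowOf w μ r - j)  ≡⟨ divN-of-offset (μ r - k) (+ c - + J) (ℤP.i≤j⇒0≤j-i (ℤ.+≤+ J≤c))
                                        (ℤP.≤-<-trans (ℤP.i-j≤i (+ c) (+ J)) (ℤ.+<+ (FP.toℕ<n (w ⟨$⟩ʳ r))))
                                        (windowOf-split w μ j r) ⟩
        μ r - k                    ≡⟨ sym (ℤP.+-identityʳ _) ⟩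
        μ r - k - 0ℤ               ≡⟨ cong (λ u → μ r - k - u) (sym (ϖ'-no J (w ⟨$⟩ʳ r) J≤c)) ⟩
        μ r - k - ϖ' J (w ⟨$⟩ʳ r)  ∎
        where open ≡-Reasoning
      by-case (inj₂ c<J) = begin
        divN (windowOf w μ r - j)  ≡⟨ divN-of-offset (μ r - k - 1ℤ) (Nℤ + (+ c - + J))
                                        (≤-from-diff (ℤP.+-mono-≤ (ℤ.+≤+ {J} {N} (ℕP.<⇒≤ (modN<N (j - 1ℤ)))) (ℤ.+≤+ {0} {c} ℕ.z≤n))
                                                     (shape₀ Nℤ (+ c) (+ J)))
                                        (<-from-diff (ℤ.+<+ c<J) (shape₁ Nℤ (+ c) (+ J)))
                                        (trans (windowOf-split w μ j r) (shape (μ r - k) (+ c - + J) Nℤ)) ⟩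
        μ r - k - 1ℤ               ≡⟨ cong (λ u → μ r - k - u) (sym (ϖ'-yes J (w ⟨$⟩ʳ r) c<J)) ⟩
        μ r - k - ϖ' J (w ⟨$⟩ʳ r)  ∎
        where open ≡-Reasoning

    countAt-windowOf : ∀ w μ i j r →
      countAt (windowOf w μ) i j r ≡ (shiftedWeight w μ (suc (toℕ i)) (modN (j - 1ℤ)) r - divN (j - 1ℤ)) ⁺
    countAt-windowOf w μ i j r =
      cong _⁺ (trans (cong (_+ 𝟙≤ r i) (divN-windowOf w μ j r))
                     (rearrange (μ r) (ϖ' (suc (toℕ i)) r) (ϖ' (modN (j - 1ℤ)) (w ⟨$⟩ʳ r)) (divN (j - 1ℤ))))
      where
      rearrange : ∀ a b p k → a - k - p + b ≡ a + b - p - k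
      rearrange = solve-∀

    excess-dom : ∀ k (v : Weight n) → excess k (dom v) ≡ ∑ (λ r → (v r - k) ⁺)
    excess-dom k v = trans (sumℤ-↭ (↭P.map⁺ (λ x → (x - k) ⁺) (sort-↭ (tabulate v))))
                           (cong sumℤ (LP.map-tabulate v (λ x → (x - k) ⁺)))

    count-windowOf : ∀ w μ i j →
      count (windowOf w μ) i j ≡ excess (divN (j - 1ℤ)) (dom (shiftedWeight w μ (suc (toℕ i)) (modN (j - 1ℤ))))
    count-windowOf w μ i j =
      trans (∑-cong (countAt-windowOf w μ i j))
            (sym (excess-dom (divN (j - 1ℤ)) (shiftedWeight w μ (suc (toℕ i)) (modN (j - 1ℤ)))))

    dom-⪯⇔excess≤ : ∀ (v₁ v₂ : Weight n) → ∑ v₁ ≡ ∑ v₂ → dom v₁ ⪯ dom v₂ ⇔ (∀ k → excess k (dom v₁) ≤ excess k (dom v₂))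
    dom-⪯⇔excess≤ v₁ v₂ same-sum =
      ⪯⇔excess≤ (dom v₁) (dom v₂) (sort-↗ (toList v₁)) (sort-↗ (toList v₂))
                 (trans (length-dom v₁) (sym (length-dom v₂)))
                 (trans (sumℤ-↭ (sort-↭ (tabulate v₁))) (trans same-sum (sym (sumℤ-↭ (sort-↭ (tabulate v₂))))))
      where
      length-dom : ∀ v → length (dom v) ≡ N
      length-dom v = trans (↭P.↭-length (sort-↭ (tabulate v))) (LP.length-tabulate v)

    πy≗extend-windowOf : ∀ w μ t → πy w μ t ≡ extend (windowOf w μ) t
    πy≗extend-windowOf w μ t = shape (quo n t) (μ (rem n t)) Nℤ _
      where
      shape : ∀ q m N s → (q + m) * N + s ≡ m * N + s + q * N
      shape = solve-∀

    BruhatLe-cong : ∀ {f f′ g g′} → (∀ t → f t ≡ f′ t) → (∀ t → g t ≡ g′ t) → BruhatLe n f g → BruhatLe n f′ g′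
    BruhatLe-cong f≗f′ g≗g′ (ws , (represents-g , minimal) , us , us⊆ws , represents-f) =
      ws , ((λ t → trans (represents-g t) (g≗g′ t)) , (λ vs h → minimal vs (λ t → trans (h t) (sym (g≗g′ t)))))
         , us , us⊆ws , (λ t → trans (represents-f t) (f≗f′ t))

    Dominance : Permutation′ N → Weight n → Permutation′ N → Weight n → Set
    Dominance w₁ μ₁ w₂ μ₂ = ∀ (i j : ℕ) → 1 ℕ.≤ i → i ℕ.≤ suc n → 1 ℕ.≤ j → j ℕ.≤ suc n →
      dom (shiftedWeight w₁ μ₁ i (j ℕ.∸ 1)) ⪯ dom (shiftedWeight w₂ μ₂ i (j ℕ.∸ 1))

    module _ (w₁ w₂ : Permutation′ N) (μ₁ μ₂ : Weight n) (μ₁∈ZΦ′ : InZΦ' μ₁) (μ₂∈ZΦ′ : InZΦ' μ₂) where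
      private
        dominance⇔excess≤ : ∀ i J → dom (shiftedWeight w₁ μ₁ i J) ⪯ dom (shiftedWeight w₂ μ₂ i J)
          ⇔ (∀ k → excess k (dom (shiftedWeight w₁ μ₁ i J)) ≤ excess k (dom (shiftedWeight w₂ μ₂ i J)))
        dominance⇔excess≤ i J = dom-⪯⇔excess≤ (shiftedWeight w₁ μ₁ i J) (shiftedWeight w₂ μ₂ i J)
          (trans (∑-shiftedWeight w₁ μ₁ i J μ₁∈ZΦ′) (sym (∑-shiftedWeight w₂ μ₂ i J μ₂∈ZΦ′)))

      ≼⇒dominance : windowOf w₁ μ₁ ≼ windowOf w₂ μ₂ → Dominance w₁ μ₁ w₂ μ₂
      ≼⇒dominance W₁≼W₂ (suc i) (suc J) _ (ℕ.s≤s i≤n) _ (ℕ.s≤s J≤n) =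
        Equivalence.from (dominance⇔excess≤ (suc i) J) λ k →
          subst₂ _≤_ (count-at-level w₁ μ₁ k) (count-at-level w₂ μ₂ k) (W₁≼W₂ i′ (1ℤ + + J + k * Nℤ))
        where
        i′ : Fin N
        i′ = F.fromℕ< (ℕ.s≤s i≤n)
        count-at-level : ∀ w μ k → count (windowOf w μ) i′ (1ℤ + + J + k * Nℤ) ≡ excess k (dom (shiftedWeight w μ (suc i) J))
        count-at-level w μ k = begin
          count (windowOf w μ) i′ j
            ≡⟨ count-windowOf w μ i′ j ⟩
          excess (divN (j - 1ℤ)) (dom (shiftedWeight w μ (suc (toℕ i′)) (modN (j - 1ℤ))))
            ≡⟨ cong₂ (λ r k′ → excess k′ (dom (shiftedWeight w μ (suc r) (modN (j - 1ℤ)))))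
                     (FP.toℕ-fromℕ< (ℕ.s≤s i≤n)) (proj₂ (level J k (ℕ.s≤s J≤n))) ⟩
          excess k (dom (shiftedWeight w μ (suc i) (modN (j - 1ℤ))))
            ≡⟨ cong (λ J′ → excess k (dom (shiftedWeight w μ (suc i) J′))) (proj₁ (level J k (ℕ.s≤s J≤n))) ⟩
          excess k (dom (shiftedWeight w μ (suc i) J))  ∎
          where
          open ≡-Reasoning
          j : ℤ
          j = 1ℤ + + J + k * Nℤ

      dominance⇒≼ : Dominance w₁ μ₁ w₂ μ₂ → windowOf w₁ μ₁ ≼ windowOf w₂ μ₂
      dominance⇒≼ dominance i j =
        subst₂ _≤_ (sym (count-windowOf w₁ μ₁ i j)) (sym (count-windowOf w₂ μ₂ i j))
          (Equivalence.to (dominance⇔excess≤ (suc (toℕ i)) (modN (j - 1ℤ)))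
            (dominance (suc (toℕ i)) (suc (modN (j - 1ℤ))) (ℕ.s≤s ℕ.z≤n) (FP.toℕ<n i) (ℕ.s≤s ℕ.z≤n) (modN<N (j - 1ℤ)))
            (divN (j - 1ℤ)))

open import Data.Nat using (ℕ; suc; _≤_; _∸_)
open import Data.Fin.Permutation using (Permutation′)
open import Function using (_∘_)
open import Function.Bundles using (_⇔_; mk⇔)
open import Relation.Binary.PropositionalEquality using (sym)

theorem6p4 : (n : ℕ) → 1 ≤ n →
    (w₁ w₂ : Permutation′ (suc n)) (μ₁ μ₂ : Weight n) →
    InZΦ' μ₁ → InZΦ' μ₂ →
    BruhatLeY w₁ μ₁ w₂ μ₂ ⇔
      (∀ (i j : ℕ) → 1 ≤ i → i ≤ suc n → 1 ≤ j → j ≤ suc n →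
        dom ((μ₁ +ʷ ϖ' i) -ʷ actInv w₁ (ϖ' (j ∸ 1)))
          ⪯ dom ((μ₂ +ʷ ϖ' i) -ʷ actInv w₂ (ϖ' (j ∸ 1))))
theorem6p4 n n≥1 w₁ w₂ μ₁ μ₂ μ₁∈ZΦ′ μ₂∈ZΦ′ = mk⇔
  (λ y₁≤y₂ → ≼⇒dominance w₁ w₂ μ₁ μ₂ μ₁∈ZΦ′ μ₂∈ZΦ′
               (bruhat⇒≼ W₁ W₂ (BruhatLe-cong (πy≗extend-windowOf w₁ μ₁) (πy≗extend-windowOf w₂ μ₂) y₁≤y₂)))
  (λ dominance → BruhatLe-cong (sym ∘ πy≗extend-windowOf w₁ μ₁) (sym ∘ πy≗extend-windowOf w₂ μ₂)
                   (≼⇒bruhat W₁ W₂ (windowOf-affine w₁ μ₁ μ₁∈ZΦ′) (windowOf-affine w₂ μ₂ μ₂∈ZΦ′)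
                     (dominance⇒≼ w₁ w₂ μ₁ μ₂ μ₁∈ZΦ′ μ₂∈ZΦ′ dominance)))
  where
  open AffineBruhat.AffineWindows n n≥1
  W₁ W₂ : Window
  W₁ = windowOf w₁ μ₁
  W₂ = windowOf w₂ μ₂
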